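{- Let $p>3$ be a prime and let $k$ be an integer with $0<k\le (p-1)/2$. Then $$\frac{1}{p}\binom{p-1+2k}{(p-1)/2+k}\equiv\left(\frac{ -1}{p}\right)4^{p-1}\frac{4^{2k}}{2k\binom{2k}{k}}\bigl(1-p(H_{2k-1}-H_{k-1})\bigr)\pmod{p^2}.$$ In particular, $$\frac{1}{p}\binom{p-1+2k}{(p-1)/2+k}\equiv\left(\frac{ -1}{p}\right)\frac{4^{2k}}{2k\binom{2k}{k}}\pmod{p}.$$
   Context: $H_n=\sum_{j=1}^n 1/j$ denotes the $n$-th harmonic number, with $H_0=0$. $\left(\frac{ -1}{p}\right)=(-1)^{(p-1)/2}$ is the Legendre symbol. A congruence between rational numbers modulo $p^r$ means that their difference is a rational number whose numerator (in lowest terms) is divisible by $p^r$ and whose denominator is coprime to $p$. -}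

module Defs where

open import Data.Nat as ℕ using (ℕ; zero; suc)
open import Data.Integer as ℤ using (ℤ; +_)
open import Data.Rational as ℚ using (ℚ; ↥_; ↧ₙ_; 0ℚ; 1ℚ; _/_)
open import Data.Nat.Divisibility using (_∣_)
open import Relation.Nullary using (¬_)
open import Data.Product using (_×_)

-- a / b as a rational for natural numbers a, b; only ever used with b ≠ 0
-- (the value 0 for b = 0 is an irrelevant convention).
fracℕ : ℕ → ℕ → ℚ
fracℕ a zero = 0ℚ
fracℕ a (suc b) = (+ a) / suc b

H : ℕ → ℚ
H zero = 0ℚ
H (suc n) = H n ℚ.+ fracℕ 1 (suc n)

_≡_[mod_^_] : ℚ → ℚ → ℕ → ℕ → Set
x ≡ y [mod p ^ r ] =
  (p ℕ.^ r) ∣ ℤ.∣ ↥ (x ℚ.- y) ∣ × ¬ (p ∣ ↧ₙ (x ℚ.- y))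

legendre-1 : ℕ → ℚ
legendre-1 p = ((ℤ.- (+ 1)) ℤ.^ ((p ℕ.∸ 1) ℕ./ 2)) / 1

module Submission where

-- Write p = 2n + 1 and P for p read as an integer. Expanding ∏_{j≤n} (j - P)
-- and 2ⁿ ∏_{j≤n} (2j - P) to first order in P gives
--   (-1)ⁿ C(2n,n) n! ≡ n! (1 - P Hₙ) ≡ 4ⁿ n! (1 - P Hₙ / 2)   (mod p²),
-- and combining the two yields 4ⁿ ≡ 1 (mod p) and Morley's congruence
-- (-1)ⁿ C(2n,n) ≡ 4^(p-1) (mod p²). The binomial of the theorem is
-- C(2(n+k), n+k), and
--   C(2(n+k), n+k) ∏_{j≤k} (P + 2j - 1)² = C(2n,n) 4ᵏ ∏_{0≤j<2k} (P + j),
-- so it is divisible by p. Expanding both products to first order in P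
-- brings in H_{2k-1} and the odd harmonic sum Σ_{j≤k} 1/(2j-1), which
-- 2 Σ_{j≤k} 1/(2j-1) = 2 H_{2k-1} - H_{k-1} turns into the stated form.
-- All denominators are prime to p, so the resulting congruences of integers
-- give the congruences of rationals.

open import Data.Maybe.Base using (Maybe; just; nothing)
open import Data.Nat as ℕ using (ℕ; zero; suc; _!; _<_; _≤_; z≤n; s≤s; NonZero)
import Data.Nat.Properties as ℕₚ
open import Data.Nat.Combinatorics using (_C_; nCk≡n!/k![n-k]!; k![n∸k]!∣n!)
import Data.Nat.Coprimality as Coprimality
open import Data.Nat.DivMod using (m*[n/m]≡n; m*n/n≡m; m%n<n; m≡m%n+[m/n]*n)
open import Data.Nat.Divisibility as ℕ∣ using (_∤_; >⇒∤) renaming (_∣_ to _∣ℕ_)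
open import Data.Nat.Primality
  using (Prime; euclidsLemma; prime⇒nonTrivial; prime⇒nonZero; prime⇒irreducible)
import Data.Nat.Tactic.RingSolver as ℕ-Solver
open import Data.Integer as ℤ using (ℤ; +_; _+_; _*_; _-_; -_; _^_; ∣_∣)
import Data.Integer.Properties as ℤₚ
open import Data.Integer.Divisibility.Signed
  using (_∣_; divides; ∣m∣n⇒∣m+n; ∣m∣n⇒∣m-n; ∣n⇒∣m*n; ∣m⇒∣-m; ∣⇒∣ᵤ; ∣ᵤ⇒∣)
open import Data.Integer.Tactic.RingSolver using (solve-∀)
open import Data.Rational as ℚ using (ℚ; mkℚ; 1ℚ; 0ℚ; toℚᵘ)
import Data.Rational.Properties as ℚₚ
open import Data.Rational.Unnormalised as ℚᵘ using (mkℚᵘ; *≡*)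
import Data.Rational.Unnormalised.Properties as ℚᵘₚ
open import Data.Product using (_×_; _,_; ∃-syntax)
open import Data.Sum using ([_,_]′; inj₁; inj₂)
open import Level using (0ℓ)
open import Relation.Binary.Bundles using (Setoid)
open import Relation.Binary.PropositionalEquality
  using (_≡_; refl; sym; trans; cong; cong₂; subst; module ≡-Reasoning)
import Relation.Binary.Reasoning.Setoid as SetoidReasoning
open import Relation.Nullary using (yes; no; contradiction)
open import Tactic.RingSolver using () renaming (solve-∀ to ℚ-solve-∀)
import Tactic.RingSolver.Core.AlmostCommutativeRing as ACR
open import Defs

-- Congruences of integers

module Modulo (m : ℤ) where

  -- A record rather than a synonym for m ∣ x - y, so that x and y can be
  -- inferred from the type.
  infix 4 _≋_
  record _≋_ (x y : ℤ) : Set where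
    constructor mk≋
    field divides-difference : m ∣ x - y
  open _≋_ public

  ∣-subst : ∀ {a b} → a ≡ b → m ∣ a → m ∣ b
  ∣-subst refl d = d

  ≡⇒≋ : ∀ {x y} → x ≡ y → x ≋ y
  ≡⇒≋ {x} refl = mk≋ (divides (+ 0) (ℤₚ.+-inverseʳ x))

  ≋-refl : ∀ {x} → x ≋ x
  ≋-refl = ≡⇒≋ refl

  ≋-sym : ∀ {x y} → x ≋ y → y ≋ x
  ≋-sym {x} {y} (mk≋ d) = mk≋ (∣-subst (identity x y) (∣m⇒∣-m d))
    where identity : ∀ x y → - (x - y) ≡ y - x
          identity = solve-∀

  ≋-trans : ∀ {x y z} → x ≋ y → y ≋ z → x ≋ z
  ≋-trans {x} {y} {z} (mk≋ d) (mk≋ e) = mk≋ (∣-subst (identity x y z) (∣m∣n⇒∣m+n d e))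
    where identity : ∀ x y z → (x - y) + (y - z) ≡ x - z
          identity = solve-∀

  ≋-setoid : Setoid _ _
  ≋-setoid = record
    { Carrier = ℤ ; _≈_ = _≋_
    ; isEquivalence = record { refl = ≋-refl ; sym = ≋-sym ; trans = ≋-trans } }

  ≋-+ : ∀ {x x′ y y′} → x ≋ x′ → y ≋ y′ → x + y ≋ x′ + y′
  ≋-+ {x} {x′} {y} {y′} (mk≋ d) (mk≋ e) = mk≋ (∣-subst (identity x x′ y y′) (∣m∣n⇒∣m+n d e))
    where identity : ∀ x x′ y y′ → (x - x′) + (y - y′) ≡ (x + y) - (x′ + y′)
          identity = solve-∀

  ≋-* : ∀ {x x′ y y′} → x ≋ x′ → y ≋ y′ → x * y ≋ x′ * y′
  ≋-* {x} {x′} {y} {y′} (mk≋ d) (mk≋ e) =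
    mk≋ (∣-subst (identity x x′ y y′) (∣m∣n⇒∣m+n (∣n⇒∣m*n y d) (∣n⇒∣m*n x′ e)))
    where identity : ∀ x x′ y y′ → y * (x - x′) + x′ * (y - y′) ≡ x * y - x′ * y′
          identity = solve-∀

  ≋-*ˡ : ∀ c {y y′} → y ≋ y′ → c * y ≋ c * y′
  ≋-*ˡ c = ≋-* (≋-refl {c})

  ≋-*ʳ : ∀ c {y y′} → y ≋ y′ → y * c ≋ y′ * c
  ≋-*ʳ c e = ≋-* e (≋-refl {c})

  ≋-resp-∣ : ∀ {x y} → x ≋ y → m ∣ x → m ∣ y
  ≋-resp-∣ {x} {y} (mk≋ d) m∣x = ∣-subst (identity x y) (∣m∣n⇒∣m-n m∣x d)
    where identity : ∀ x y → x - (x - y) ≡ y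
          identity = solve-∀

  +-multiple-≋ : ∀ c x → x + c * m ≋ x
  +-multiple-≋ c x = mk≋ (divides c (identity c x m))
    where identity : ∀ c x m → x + c * m - x ≡ c * m
          identity = solve-∀

  open SetoidReasoning ≋-setoid public

≋-weaken : ∀ {m m′ x y} → Modulo._≋_ (m * m′) x y → Modulo._≋_ m x y
≋-weaken {m} {m′} (Modulo.mk≋ (divides q e)) = Modulo.mk≋ (divides (q * m′) (trans e (reassoc q m m′)))
  where reassoc : ∀ q m m′ → q * (m * m′) ≡ q * m′ * m
        reassoc = solve-∀

≋-scale : ∀ c {m x y} → Modulo._≋_ m x y → Modulo._≋_ (c * m) (c * x) (c * y)
≋-scale c {m} {x} {y} (Modulo.mk≋ (divides q e)) =
  Modulo.mk≋ (divides q (trans (distrib c x y) (trans (cong (c *_) e) (reassoc c q m))))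
  where distrib : ∀ c x y → c * x - c * y ≡ c * (x - y)
        distrib = solve-∀
        reassoc : ∀ c q m → c * (q * m) ≡ q * (c * m)
        reassoc = solve-∀

pos-suc : ∀ m → + suc m ≡ + m + + 1
pos-suc m = trans (ℤₚ.pos-+ 1 m) (ℤₚ.+-comm (+ 1) (+ m))

pos-even : ∀ j → + (j ℕ.+ j) ≡ + 2 * + j
pos-even j = trans (ℤₚ.pos-+ j j) (identity (+ j))
  where identity : ∀ j → j + j ≡ + 2 * j
        identity = solve-∀

pos-m+2k : ∀ m k → + (m ℕ.+ (k ℕ.+ k)) ≡ + m + + 2 * + k
pos-m+2k m k = trans (ℤₚ.pos-+ m (k ℕ.+ k)) (cong (_+_ (+ m)) (pos-even k))

pos-^ : ∀ m j → + (m ℕ.^ j) ≡ (+ m) ^ j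
pos-^ m zero    = refl
pos-^ m (suc j) = trans (ℤₚ.pos-* m (m ℕ.^ j)) (cong (+ m *_) (pos-^ m j))

^-distribʳ-* : ∀ a b n → (a * b) ^ n ≡ a ^ n * b ^ n
^-distribʳ-* a b zero    = refl
^-distribʳ-* a b (suc n) = trans (cong ((a * b) *_) (^-distribʳ-* a b n)) (regroup a b (a ^ n) (b ^ n))
  where regroup : ∀ a b s t → a * b * (s * t) ≡ a * s * (b * t)
        regroup = solve-∀

odd : ℕ → ℤ
odd j = + 2 * + j - + 1

odd-suc : ∀ k → odd (suc (suc k)) ≡ + 3 + + 2 * + k
odd-suc k = trans (cong (λ c → + 2 * c - + 1) (ℤₚ.pos-+ 2 k)) (identity (+ k))
  where identity : ∀ k → + 2 * (+ 2 + k) - + 1 ≡ + 3 + + 2 * k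
        identity = solve-∀

pos-odd : ∀ j → + (j ℕ.+ suc j) ≡ odd (suc j)
pos-odd j = begin
  + (j ℕ.+ suc j)         ≡⟨ trans (ℤₚ.pos-+ j (suc j)) (cong (_+_ (+ j)) (pos-suc j)) ⟩
  + j + (+ j + + 1)       ≡⟨ identity (+ j) ⟩
  + 2 * (+ j + + 1) - + 1 ≡⟨ cong (λ J → + 2 * J - + 1) (sym (pos-suc j)) ⟩
  odd (suc j)             ∎
  where
  open ≡-Reasoning
  identity : ∀ j → j + (j + + 1) ≡ + 2 * (j + + 1) - + 1
  identity = solve-∀

-- Products over 1, …, n and their first-order perturbations

∏ : ℕ → (ℕ → ℤ) → ℤ
∏ zero    f = + 1
∏ (suc n) f = ∏ n f * f (suc n)

-- The coefficient of ε in ∏ n (λ j → f j + ε), i.e. ∏ n f · Σ_{j ≤ n} 1 / f j.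
∂∏ : ℕ → (ℕ → ℤ) → ℤ
∂∏ zero    f = + 0
∂∏ (suc n) f = ∂∏ n f * f (suc n) + ∏ n f

∏-cong : ∀ n {f g} → (∀ j → f (suc j) ≡ g (suc j)) → ∏ n f ≡ ∏ n g
∏-cong zero    f≡g = refl
∏-cong (suc n) f≡g = cong₂ _*_ (∏-cong n f≡g) (f≡g n)

∏-distrib-* : ∀ n f g → ∏ n (λ j → f j * g j) ≡ ∏ n f * ∏ n g
∏-distrib-* zero    f g = refl
∏-distrib-* (suc n) f g =
  trans (cong (_* (f (suc n) * g (suc n))) (∏-distrib-* n f g)) (regroup (∏ n f) (∏ n g) (f (suc n)) (g (suc n)))
  where regroup : ∀ a b c d → a * b * (c * d) ≡ a * c * (b * d)
        regroup = solve-∀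

∏-*ˡ : ∀ n c f → ∏ n (λ j → c * f j) ≡ c ^ n * ∏ n f
∏-*ˡ zero    c f = refl
∏-*ˡ (suc n) c f = trans (cong (_* (c * f (suc n))) (∏-*ˡ n c f)) (regroup (c ^ n) (∏ n f) c (f (suc n)))
  where regroup : ∀ a b c d → a * b * (c * d) ≡ c * a * (b * d)
        regroup = solve-∀

∏-neg : ∀ n f → ∏ n (λ j → - f j) ≡ (- + 1) ^ n * ∏ n f
∏-neg n f = trans (∏-cong n (λ j → sym (ℤₚ.-1*i≡-i (f (suc j))))) (∏-*ˡ n (- + 1) f)

∏-pairs : ∀ n f → ∏ (n ℕ.+ n) f ≡ ∏ n (λ j → f (ℕ.pred (j ℕ.+ j)) * f (j ℕ.+ j))
∏-pairs zero    f = refl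
∏-pairs (suc n) f rewrite ℕₚ.+-suc n n =
  trans (ℤₚ.*-assoc (∏ (n ℕ.+ n) f) (f (suc (n ℕ.+ n))) (f (suc (suc (n ℕ.+ n)))))
        (cong (_* (f (suc (n ℕ.+ n)) * f (suc (suc (n ℕ.+ n))))) (∏-pairs n f))

∏-identity : ∀ n → ∏ n (λ j → + j) ≡ + (n !)
∏-identity zero    = refl
∏-identity (suc n) =
  trans (cong (_* + suc n) (∏-identity n)) (trans (ℤₚ.*-comm (+ (n !)) (+ suc n)) (sym (ℤₚ.pos-* (suc n) (n !))))

∏-falling : ∀ n e → ∏ n (λ j → + suc (n ℕ.+ e) - + j) * + (e !) ≡ + ((n ℕ.+ e) !)
∏-falling zero    e = ℤₚ.*-identityˡ (+ (e !))
∏-falling (suc n) e = begin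
  ∏ n f * (+ suc (suc n ℕ.+ e) - + suc n) * + (e !)
    ≡⟨ cong₂ (λ a b → a * b * + (e !)) (∏-cong n λ j → shift (suc j)) last ⟩
  ∏ n g * + suc e * + (e !)
    ≡⟨ trans (ℤₚ.*-assoc (∏ n g) (+ suc e) (+ (e !))) (cong (∏ n g *_) (sym (ℤₚ.pos-* (suc e) (e !)))) ⟩
  ∏ n g * + (suc e !)
    ≡⟨ ∏-falling n (suc e) ⟩
  + ((n ℕ.+ suc e) !)
    ≡⟨ cong (λ m → + (m !)) (ℕₚ.+-suc n e) ⟩
  + ((suc n ℕ.+ e) !) ∎
  where
  open ≡-Reasoning
  f g : ℕ → ℤ
  f j = + suc (suc n ℕ.+ e) - + j
  g j = + suc (n ℕ.+ suc e) - + j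
  shift : ∀ j → f j ≡ g j
  shift j = cong (λ m → + suc m - + j) (sym (ℕₚ.+-suc n e))
  last : + suc (suc n ℕ.+ e) - + suc n ≡ + suc e
  last = trans (cong (λ m → + m - + suc n) (sym (ℕₚ.+-suc (suc n) e)))
               (trans (cong (_- + suc n) (ℤₚ.pos-+ (suc n) (suc e))) (identity (+ suc n) (+ suc e)))
    where identity : ∀ a b → a + b - a ≡ b
          identity = solve-∀

∏-falling₀ : ∀ m → ∏ m (λ j → + suc m - + j) ≡ + (m !)
∏-falling₀ m = trans (sym (ℤₚ.*-identityʳ (∏ m (λ j → + suc m - + j))))
  (subst (λ r → ∏ m (λ j → + suc r - + j) * + 1 ≡ + (r !)) (ℕₚ.+-identityʳ m) (∏-falling m 0))

∂∏-*ˡ : ∀ n c f → c * ∂∏ n (λ j → c * f j) ≡ c ^ n * ∂∏ n f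
∂∏-*ˡ zero    c f = ℤₚ.*-zeroʳ c
∂∏-*ˡ (suc n) c f = begin
  c * (∂∏ n cf * (c * f (suc n)) + ∏ n cf)
    ≡⟨ distribute c (∂∏ n cf) (f (suc n)) (∏ n cf) ⟩
  c * ∂∏ n cf * (c * f (suc n)) + c * ∏ n cf
    ≡⟨ cong₂ (λ d e → d * (c * f (suc n)) + c * e) (∂∏-*ˡ n c f) (∏-*ˡ n c f) ⟩
  c ^ n * ∂∏ n f * (c * f (suc n)) + c * (c ^ n * ∏ n f)
    ≡⟨ collect c (c ^ n) (∂∏ n f) (f (suc n)) (∏ n f) ⟩
  c * c ^ n * (∂∏ n f * f (suc n) + ∏ n f) ∎
  where
  open ≡-Reasoning
  cf = λ j → c * f j
  distribute : ∀ c d x e → c * (d * (c * x) + e) ≡ c * d * (c * x) + c * e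
  distribute = solve-∀
  collect : ∀ c t d x e → t * d * (c * x) + c * (t * e) ≡ c * t * (d * x + e)
  collect = solve-∀

∏-perturb : ∀ (P c : ℤ) n f → let open Modulo (P * P) in
            ∏ n (λ j → f j + c * P) ≋ ∏ n f + c * P * ∂∏ n f
∏-perturb P c zero f = Modulo.≡⇒≋ (P * P) (identity c P)
  where identity : ∀ c P → + 1 ≡ + 1 + c * P * + 0
        identity = solve-∀
∏-perturb P c (suc n) f = begin
  ∏ n (λ j → f j + c * P) * (x + c * P)             ≈⟨ ≋-*ʳ (x + c * P) (∏-perturb P c n f) ⟩
  (a + c * P * b) * (x + c * P)                     ≡⟨ expand a b x c P ⟩
  a * x + c * P * (b * x + a) + c * c * b * (P * P) ≈⟨ +-multiple-≋ (c * c * b) (a * x + c * P * (b * x + a)) ⟩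
  a * x + c * P * (b * x + a)                       ∎
  where
  open Modulo (P * P)
  a = ∏ n f
  b = ∂∏ n f
  x = f (suc n)
  expand : ∀ a b x c P → (a + c * P * b) * (x + c * P) ≡ a * x + c * P * (b * x + a) + c * c * b * (P * P)
  expand = solve-∀

∤-* : ∀ {p a b} → Prime p → p ∤ a → p ∤ b → p ∤ a ℕ.* b
∤-* {a = a} {b} isPrime p∤a p∤b p∣ab = [ p∤a , p∤b ]′ (euclidsLemma a b isPrime p∣ab)

∤-! : ∀ {p m} → Prime p → m < p → p ∤ m !
∤-! {p} {zero}  isPrime _   = >⇒∤ (ℕ.nonTrivial⇒n>1 p {{prime⇒nonTrivial isPrime}})
∤-! {p} {suc m} isPrime m<p = ∤-* isPrime (>⇒∤ m<p) (∤-! isPrime (ℕₚ.<-trans (ℕₚ.n<1+n m) m<p))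

∤-2^ : ∀ {p} j → Prime p → 2 < p → p ∤ 2 ℕ.^ j
∤-2^ zero    isPrime 2<p = ∤-! {m = 0} isPrime (ℕₚ.<-trans (ℕₚ.n<1+n 0) (ℕₚ.<-trans (ℕₚ.n<1+n 1) 2<p))
∤-2^ (suc j) isPrime 2<p = ∤-* isPrime (>⇒∤ 2<p) (∤-2^ j isPrime 2<p)

^∣-cancelʳ : ∀ {p} r {a d} → Prime p → p ∤ d → p ℕ.^ r ∣ℕ a ℕ.* d → p ℕ.^ r ∣ℕ a
^∣-cancelʳ zero {a} _ _ _ = ℕ∣.divides a (sym (ℕₚ.*-identityʳ a))
^∣-cancelʳ {p} (suc r) {a} {d} isPrime p∤d pʳ⁺¹∣ad
  with euclidsLemma a d isPrime (ℕ∣.∣-trans (ℕ∣.m∣m*n (p ℕ.^ r)) pʳ⁺¹∣ad)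
... | inj₂ p∣d = contradiction p∣d p∤d
... | inj₁ (ℕ∣.divides q refl) =
  subst (p ℕ.^ suc r ∣ℕ_) (ℕₚ.*-comm p q) (ℕ∣.*-monoʳ-∣ p (^∣-cancelʳ r isPrime p∤d pʳ∣qd))
  where
  instance _ = prime⇒nonZero isPrime
  reassoc : ∀ q p d → q ℕ.* p ℕ.* d ≡ p ℕ.* (q ℕ.* d)
  reassoc = ℕ-Solver.solve-∀
  pʳ∣qd : p ℕ.^ r ∣ℕ q ℕ.* d
  pʳ∣qd = ℕ∣.*-cancelˡ-∣ p (subst (p ℕ.^ suc r ∣ℕ_) (reassoc q p d) pʳ⁺¹∣ad)

^∣-cancelˡ-ℤ : ∀ {p} r c z → Prime p → p ∤ ∣ c ∣ → + (p ℕ.^ r) ∣ c * z → + (p ℕ.^ r) ∣ z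
^∣-cancelˡ-ℤ {p} r c z isPrime p∤c pʳ∣cz = ∣ᵤ⇒∣ (^∣-cancelʳ r isPrime p∤c
  (subst (p ℕ.^ r ∣ℕ_) (trans (ℤₚ.abs-* c z) (ℕₚ.*-comm ∣ c ∣ ∣ z ∣)) (∣⇒∣ᵤ pʳ∣cz)))

∤-*ℤ : ∀ {p} a b → Prime p → p ∤ ∣ a ∣ → p ∤ ∣ b ∣ → p ∤ ∣ a * b ∣
∤-*ℤ {p} a b isPrime p∤a p∤b = subst (p ∤_) (sym (ℤₚ.abs-* a b)) (∤-* isPrime p∤a p∤b)

∤-*ℤ⇒∤ˡ : ∀ {p} a b → p ∤ ∣ a * b ∣ → p ∤ ∣ a ∣
∤-*ℤ⇒∤ˡ {p} a b p∤ab p∣a = p∤ab (subst (p ∣ℕ_) (sym (ℤₚ.abs-* a b)) (ℕ∣.∣-trans p∣a (ℕ∣.m∣m*n ∣ b ∣)))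

∤-*ℤ⇒∤ʳ : ∀ {p} a b → p ∤ ∣ a * b ∣ → p ∤ ∣ b ∣
∤-*ℤ⇒∤ʳ {p} a b p∤ab p∣b = p∤ab (subst (p ∣ℕ_) (sym (ℤₚ.abs-* a b)) (ℕ∣.∣-trans p∣b (ℕ∣.n∣m*n ∣ a ∣)))

≋-cancelˡ : ∀ {p} r {m} c {x y} → Prime p → m ≡ + (p ℕ.^ r) → p ∤ ∣ c ∣ →
            Modulo._≋_ m (c * x) (c * y) → Modulo._≋_ m x y
≋-cancelˡ r c {x} {y} isPrime refl p∤c (Modulo.mk≋ d) =
  Modulo.mk≋ (^∣-cancelˡ-ℤ r c (x - y) isPrime p∤c (Modulo.∣-subst _ (factor c x y) d))
  where factor : ∀ c x y → c * x - c * y ≡ c * (x - y)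
        factor = solve-∀

binomial-factorials : ∀ {n k} → k ≤ n → (k ! ℕ.* (n ℕ.∸ k) !) ℕ.* (n C k) ≡ n !
binomial-factorials {n} {k} k≤n = trans (cong ((k ! ℕ.* (n ℕ.∸ k) !) ℕ.*_) (nCk≡n!/k![n-k]! k≤n))
  (m*[n/m]≡n {{ℕₚ._!*_!≢0 k (n ℕ.∸ k)}} (k![n∸k]!∣n! k≤n))

centralBinomial : ℕ → ℕ
centralBinomial m = (2 ℕ.* m) C m

centralBinomial-factorials : ∀ m → m ! ℕ.* m ! ℕ.* centralBinomial m ≡ (m ℕ.+ m) !
centralBinomial-factorials m = trans
  (subst (λ r → m ! ℕ.* r ! ℕ.* centralBinomial m ≡ (2 ℕ.* m) !) 2m∸m≡m (binomial-factorials m≤2m))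
  (cong (λ r → (m ℕ.+ r) !) (ℕₚ.+-identityʳ m))
  where
  m≤2m : m ≤ 2 ℕ.* m
  m≤2m = ℕₚ.m≤m+n m (m ℕ.+ 0)
  2m∸m≡m : 2 ℕ.* m ℕ.∸ m ≡ m
  2m∸m≡m = trans (cong (λ r → m ℕ.+ r ℕ.∸ m) (ℕₚ.+-identityʳ m)) (ℕₚ.m+n∸m≡n m m)

centralBinomial-suc : ∀ m → centralBinomial (suc m) ℕ.* suc m ≡ 2 ℕ.* (2 ℕ.* m ℕ.+ 1) ℕ.* centralBinomial m
centralBinomial-suc m = ℕₚ.*-cancelʳ-≡ _ _ (suc m ℕ.* (m ! ℕ.* m !)) {{nonZero}} (begin
  X ℕ.* suc m ℕ.* (suc m ℕ.* (F ℕ.* F))  ≡⟨ regroup X m F ⟩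
  suc m ! ℕ.* suc m ! ℕ.* X               ≡⟨ centralBinomial-factorials (suc m) ⟩
  (suc m ℕ.+ suc m) !                     ≡⟨ cong _! (cong suc (ℕₚ.+-suc m m)) ⟩
  (2 ℕ.+ (m ℕ.+ m)) ℕ.* ((1 ℕ.+ (m ℕ.+ m)) ℕ.* (m ℕ.+ m) !)
    ≡⟨ cong (λ r → (2 ℕ.+ (m ℕ.+ m)) ℕ.* ((1 ℕ.+ (m ℕ.+ m)) ℕ.* r)) (sym (centralBinomial-factorials m)) ⟩
  (2 ℕ.+ (m ℕ.+ m)) ℕ.* ((1 ℕ.+ (m ℕ.+ m)) ℕ.* (F ℕ.* F ℕ.* Y))
    ≡⟨ regroup′ Y m F ⟩
  2 ℕ.* (2 ℕ.* m ℕ.+ 1) ℕ.* Y ℕ.* (suc m ℕ.* (F ℕ.* F)) ∎)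
  where
  open ≡-Reasoning
  X = centralBinomial (suc m)
  Y = centralBinomial m
  F = m !
  nonZero = ℕₚ.m*n≢0 (suc m) (m ! ℕ.* m !) {{_}} {{ℕₚ._!*_!≢0 m m}}
  regroup : ∀ X m F → X ℕ.* suc m ℕ.* (suc m ℕ.* (F ℕ.* F)) ≡ (suc m ℕ.* F) ℕ.* (suc m ℕ.* F) ℕ.* X
  regroup = ℕ-Solver.solve-∀
  regroup′ : ∀ Y m F → (2 ℕ.+ (m ℕ.+ m)) ℕ.* ((1 ℕ.+ (m ℕ.+ m)) ℕ.* (F ℕ.* F ℕ.* Y))
                       ≡ 2 ℕ.* (2 ℕ.* m ℕ.+ 1) ℕ.* Y ℕ.* (suc m ℕ.* (F ℕ.* F))
  regroup′ = ℕ-Solver.solve-∀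

centralBinomial-suc-ℤ : ∀ m → + centralBinomial (suc m) * + suc m ≡ + 2 * (+ 2 * + m + + 1) * + centralBinomial m
centralBinomial-suc-ℤ m = begin
  + centralBinomial (suc m) * + suc m             ≡⟨ sym (ℤₚ.pos-* (centralBinomial (suc m)) (suc m)) ⟩
  + (centralBinomial (suc m) ℕ.* suc m)           ≡⟨ cong +_ (centralBinomial-suc m) ⟩
  + (2 ℕ.* (2 ℕ.* m ℕ.+ 1) ℕ.* centralBinomial m) ≡⟨ ℤₚ.pos-* (2 ℕ.* (2 ℕ.* m ℕ.+ 1)) (centralBinomial m) ⟩
  + (2 ℕ.* (2 ℕ.* m ℕ.+ 1)) * + centralBinomial m
    ≡⟨ cong (_* + centralBinomial m) (trans (ℤₚ.pos-* 2 (2 ℕ.* m ℕ.+ 1))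
         (cong (+ 2 *_) (trans (ℤₚ.pos-+ (2 ℕ.* m) 1) (cong (_+ + 1) (ℤₚ.pos-* 2 m))))) ⟩
  + 2 * (+ 2 * + m + + 1) * + centralBinomial m ∎
  where open ≡-Reasoning

-- Morley's congruence

-- With y = 1 + wP and P·xa ≡ P·a (mod P²), the hypothesis on 2xa becomes
-- xa ≡ a + 2wPa, which is y²a up to a multiple of P².
2xa≋ya[1+x]⇒xa≋y²a : ∀ {P a x y} → Modulo._≋_ P (x * a) a → Modulo._≋_ P y (+ 1) →
  Modulo._≋_ (P * P) (+ 2 * (x * a)) (y * a * (+ 1 + x)) → Modulo._≋_ (P * P) (x * a) (y * y * a)
2xa≋ya[1+x]⇒xa≋y²a {P} {a} {x} {y} xa≋a (Modulo.mk≋ (divides w y-1≡wP)) 2xa≋ya[1+x] = begin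
  x * a                                ≡⟨ halve (x * a) ⟩
  + 2 * (x * a) + - (x * a)            ≈⟨ ≋-+ 2xa≋ya[1+x] ≋-refl ⟩
  y * a * (+ 1 + x) + - (x * a)        ≡⟨ expand a x y w P y≡1+wP ⟩
  a + w * (P * (x * a)) + w * (P * a)  ≈⟨ ≋-+ (≋-+ (≋-refl {a}) (≋-*ˡ w (≋-scale P xa≋a))) (≋-refl {w * (P * a)}) ⟩
  a + w * (P * a) + w * (P * a)        ≡⟨ square a w P y y≡1+wP ⟩
  y * y * a + - (w * w * a) * (P * P)  ≈⟨ +-multiple-≋ (- (w * w * a)) (y * y * a) ⟩
  y * y * a                            ∎
  where
  open Modulo (P * P)
  y≡1+wP : y ≡ + 1 + w * P
  y≡1+wP = trans (identity y) (cong (_+_ (+ 1)) y-1≡wP)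
    where identity : ∀ y → y ≡ + 1 + (y - + 1)
          identity = solve-∀
  halve : ∀ z → z ≡ + 2 * z + - z
  halve = solve-∀
  expand : ∀ a x y w P → y ≡ + 1 + w * P → y * a * (+ 1 + x) + - (x * a) ≡ a + w * (P * (x * a)) + w * (P * a)
  expand a x _ w P refl = identity a x w P
    where identity : ∀ a x w P → (+ 1 + w * P) * a * (+ 1 + x) + - (x * a) ≡ a + w * (P * (x * a)) + w * (P * a)
          identity = solve-∀
  square : ∀ a w P y → y ≡ + 1 + w * P → a + w * (P * a) + w * (P * a) ≡ y * y * a + - (w * w * a) * (P * P)
  square a w P _ refl = identity a w P
    where identity : ∀ a w P → a + w * (P * a) + w * (P * a) ≡ (+ 1 + w * P) * (+ 1 + w * P) * a + - (w * w * a) * (P * P)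
          identity = solve-∀

odd>1⇒>2 : ∀ n → 1 < suc (n ℕ.+ n) → 2 < suc (n ℕ.+ n)
odd>1⇒>2 zero    (s≤s ())
odd>1⇒>2 (suc m) _ = s≤s (s≤s (ℕₚ.≤-trans (s≤s z≤n) (ℕₚ.m≤n+m (suc m) m)))

module Morley (n : ℕ) where

  -- P is 2n + 1, spelled out so that the ring solver sees its shape;
  -- b / a is the harmonic number Hₙ.
  P B L a b x y : ℤ
  P = + n + + n + + 1
  B = + centralBinomial n
  L = (- + 1) ^ n
  a = + (n !)
  b = ∂∏ n (λ j → + j)
  x = L * B
  y = (+ 4) ^ n

  module P² = Modulo (P * P)
  module P¹ = Modulo P

  P≡ : + suc (n ℕ.+ n) ≡ P
  P≡ = trans (pos-suc (n ℕ.+ n)) (cong (_+ + 1) (ℤₚ.pos-+ n n))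

  aaB≡[2n]! : a * a * B ≡ + ((n ℕ.+ n) !)
  aaB≡[2n]! = trans (cong (_* B) (sym (ℤₚ.pos-* (n !) (n !))))
    (trans (sym (ℤₚ.pos-* (n ! ℕ.* n !) (centralBinomial n))) (cong +_ (centralBinomial-factorials n)))

  ∏[P-j]≡aB : ∏ n (λ j → P - + j) ≡ a * B
  ∏[P-j]≡aB = ℤₚ.*-cancelʳ-≡ _ _ a {{ℕₚ._!≢0 n}} (begin
    ∏ n (λ j → P - + j) * a                ≡⟨ cong (λ Q → ∏ n (λ j → Q - + j) * a) (sym P≡) ⟩
    ∏ n (λ j → + suc (n ℕ.+ n) - + j) * a  ≡⟨ ∏-falling n n ⟩
    + ((n ℕ.+ n) !)                        ≡⟨ sym aaB≡[2n]! ⟩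
    a * a * B                              ≡⟨ swap a B ⟩
    a * B * a                              ∎)
    where
    open ≡-Reasoning
    swap : ∀ a B → a * a * B ≡ a * B * a
    swap = solve-∀

  ∏[P-odd]≡2ⁿa : ∏ n (λ j → P - odd j) ≡ (+ 2) ^ n * a
  ∏[P-odd]≡2ⁿa = begin
    ∏ n (λ j → P - odd j)                  ≡⟨ ∏-cong n (λ j → halve (+ suc j)) ⟩
    ∏ n (λ j → + 2 * (+ suc n - + j))      ≡⟨ ∏-*ˡ n (+ 2) (λ j → + suc n - + j) ⟩
    (+ 2) ^ n * ∏ n (λ j → + suc n - + j)  ≡⟨ cong ((+ 2) ^ n *_) (∏-falling₀ n) ⟩
    (+ 2) ^ n * a                          ∎
    where
    open ≡-Reasoning
    identity : ∀ N J → N + N + + 1 - (+ 2 * J - + 1) ≡ + 2 * (N + + 1 - J)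
    identity = solve-∀
    halve : ∀ J → P - (+ 2 * J - + 1) ≡ + 2 * (+ suc n - J)
    halve J = trans (identity (+ n) J) (cong (λ N → + 2 * (N - J)) (sym (pos-suc n)))

  2ⁿ∏[P-2j]≡aB : (+ 2) ^ n * ∏ n (λ j → P - + 2 * + j) ≡ a * B
  2ⁿ∏[P-2j]≡aB = ℤₚ.*-cancelʳ-≡ _ _ a {{ℕₚ._!≢0 n}} (begin
    (+ 2) ^ n * E * a                                ≡⟨ regroup ((+ 2) ^ n) E a ⟩
    (+ 2) ^ n * a * E                                ≡⟨ cong (_* E) (sym ∏[P-odd]≡2ⁿa) ⟩
    ∏ n (λ j → P - odd j) * E                        ≡⟨ sym (∏-distrib-* n (λ j → P - odd j) (λ j → P - + 2 * + j)) ⟩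
    ∏ n (λ j → (P - odd j) * (P - + 2 * + j))        ≡⟨ sym pairs ⟩
    ∏ (n ℕ.+ n) (λ j → P - + j)                      ≡⟨ cong (λ Q → ∏ (n ℕ.+ n) (λ j → Q - + j)) (sym P≡) ⟩
    ∏ (n ℕ.+ n) (λ j → + suc (n ℕ.+ n) - + j)        ≡⟨ ∏-falling₀ (n ℕ.+ n) ⟩
    + ((n ℕ.+ n) !)                                  ≡⟨ sym aaB≡[2n]! ⟩
    a * a * B                                        ≡⟨ swap a B ⟩
    a * B * a                                        ∎)
    where
    open ≡-Reasoning
    E = ∏ n (λ j → P - + 2 * + j)
    pairs : ∏ (n ℕ.+ n) (λ j → P - + j) ≡ ∏ n (λ j → (P - odd j) * (P - + 2 * + j))
    pairs = trans (∏-pairs n (λ j → P - + j))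
                  (∏-cong n λ j → cong₂ (λ u v → (P - u) * (P - v)) (pos-odd j) (pos-even (suc j)))
    regroup : ∀ t e a → t * e * a ≡ t * a * e
    regroup = solve-∀
    swap : ∀ a B → a * a * B ≡ a * B * a
    swap = solve-∀

  xa≡∏[j-P] : x * a ≡ ∏ n (λ j → + j + - + 1 * P)
  xa≡∏[j-P] = sym (begin
    ∏ n (λ j → + j + - + 1 * P)  ≡⟨ ∏-cong n (λ j → negate (+ suc j) P) ⟩
    ∏ n (λ j → - (P - + j))      ≡⟨ ∏-neg n (λ j → P - + j) ⟩
    L * ∏ n (λ j → P - + j)      ≡⟨ cong (L *_) ∏[P-j]≡aB ⟩
    L * (a * B)                  ≡⟨ regroup L a B ⟩
    x * a                        ∎)
    where
    open ≡-Reasoning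
    negate : ∀ j P → j + - + 1 * P ≡ - (P - j)
    negate = solve-∀
    regroup : ∀ L a B → L * (a * B) ≡ L * B * a
    regroup = solve-∀

  xa≡2ⁿ∏[2j-P] : x * a ≡ (+ 2) ^ n * ∏ n (λ j → + 2 * + j + - + 1 * P)
  xa≡2ⁿ∏[2j-P] = sym (begin
    (+ 2) ^ n * ∏ n (λ j → + 2 * + j + - + 1 * P)
      ≡⟨ cong ((+ 2) ^ n *_) (trans (∏-cong n (λ j → negate (+ suc j) P)) (∏-neg n (λ j → P - + 2 * + j))) ⟩
    (+ 2) ^ n * (L * ∏ n (λ j → P - + 2 * + j))  ≡⟨ swap ((+ 2) ^ n) L (∏ n (λ j → P - + 2 * + j)) ⟩
    L * ((+ 2) ^ n * ∏ n (λ j → P - + 2 * + j))  ≡⟨ cong (L *_) 2ⁿ∏[P-2j]≡aB ⟩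
    L * (a * B)                                  ≡⟨ regroup L a B ⟩
    x * a                                        ∎)
    where
    open ≡-Reasoning
    negate : ∀ j P → + 2 * j + - + 1 * P ≡ - (P - + 2 * j)
    negate = solve-∀
    swap : ∀ t L e → t * (L * e) ≡ L * (t * e)
    swap = solve-∀
    regroup : ∀ L a B → L * (a * B) ≡ L * B * a
    regroup = solve-∀

  xa≋a-Pb : x * a P².≋ a - P * b
  xa≋a-Pb = begin
    x * a                            ≡⟨ xa≡∏[j-P] ⟩
    ∏ n (λ j → + j + - + 1 * P)      ≈⟨ ∏-perturb P (- + 1) n (λ j → + j) ⟩
    ∏ n (λ j → + j) + - + 1 * P * b  ≡⟨ cong (λ c → c + - + 1 * P * b) (∏-identity n) ⟩
    a + - + 1 * P * b                ≡⟨ identity a P b ⟩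
    a - P * b                        ∎
    where
    open P²
    identity : ∀ a P b → a + - + 1 * P * b ≡ a - P * b
    identity = solve-∀

  2xa≋y[2a-Pb] : + 2 * (x * a) P².≋ y * (+ 2 * a - P * b)
  2xa≋y[2a-Pb] = begin
    + 2 * (x * a)                                        ≡⟨ cong (+ 2 *_) xa≡2ⁿ∏[2j-P] ⟩
    + 2 * ((+ 2) ^ n * ∏ n (λ j → 2j j + - + 1 * P))
      ≈⟨ ≋-*ˡ (+ 2) (≋-*ˡ ((+ 2) ^ n) (∏-perturb P (- + 1) n 2j)) ⟩
    + 2 * ((+ 2) ^ n * (∏ n 2j + - + 1 * P * ∂∏ n 2j))   ≡⟨ expand ((+ 2) ^ n) (∏ n 2j) P (∂∏ n 2j) ⟩
    (+ 2) ^ n * (+ 2 * ∏ n 2j - P * (+ 2 * ∂∏ n 2j))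
      ≡⟨ cong₂ (λ s t → (+ 2) ^ n * (+ 2 * s - P * t))
           (trans (∏-*ˡ n (+ 2) (λ j → + j)) (cong ((+ 2) ^ n *_) (∏-identity n)))
           (∂∏-*ˡ n (+ 2) (λ j → + j)) ⟩
    (+ 2) ^ n * (+ 2 * ((+ 2) ^ n * a) - P * ((+ 2) ^ n * b))
      ≡⟨ regroup ((+ 2) ^ n) a P b ⟩
    (+ 2) ^ n * (+ 2) ^ n * (+ 2 * a - P * b)
      ≡⟨ cong (_* (+ 2 * a - P * b)) (sym (^-distribʳ-* (+ 2) (+ 2) n)) ⟩
    y * (+ 2 * a - P * b)                                ∎
    where
    open P²
    2j : ℕ → ℤ
    2j j = + 2 * + j
    expand : ∀ t A P D → + 2 * (t * (A + - + 1 * P * D)) ≡ t * (+ 2 * A - P * (+ 2 * D))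
    expand = solve-∀
    regroup : ∀ t a P b → t * (+ 2 * (t * a) - P * (t * b)) ≡ t * t * (+ 2 * a - P * b)
    regroup = solve-∀

  2xa≋ya[1+x] : + 2 * (x * a) P².≋ y * a * (+ 1 + x)
  2xa≋ya[1+x] = begin
    + 2 * (x * a)          ≈⟨ 2xa≋y[2a-Pb] ⟩
    y * (+ 2 * a - P * b)  ≡⟨ cong (y *_) (split a P b) ⟩
    y * (a + (a - P * b))  ≈⟨ ≋-*ˡ y (≋-+ (≋-refl {a}) (≋-sym xa≋a-Pb)) ⟩
    y * (a + x * a)        ≡⟨ factor y a x ⟩
    y * a * (+ 1 + x)      ∎
    where
    open P²
    split : ∀ a P b → + 2 * a - P * b ≡ a + (a - P * b)
    split = solve-∀
    factor : ∀ y a x → y * (a + x * a) ≡ y * a * (+ 1 + x)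
    factor = solve-∀

  module _ (isPrime : Prime (suc (n ℕ.+ n))) where

    P≡p¹ : P ≡ + (suc (n ℕ.+ n) ℕ.^ 1)
    P≡p¹ = trans (sym P≡) (cong +_ (sym (ℕₚ.*-identityʳ _)))

    P²≡p² : P * P ≡ + (suc (n ℕ.+ n) ℕ.^ 2)
    P²≡p² = trans (cong₂ _*_ (sym P≡) P≡p¹) (sym (ℤₚ.pos-* (suc (n ℕ.+ n)) _))

    2<p : 2 < suc (n ℕ.+ n)
    2<p = odd>1⇒>2 n (ℕ.nonTrivial⇒n>1 _ {{prime⇒nonTrivial isPrime}})

    p∤a : suc (n ℕ.+ n) ∤ ∣ a ∣
    p∤a = ∤-! isPrime (s≤s (ℕₚ.m≤m+n n n))

    p∤2a : suc (n ℕ.+ n) ∤ ∣ + 2 * a ∣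
    p∤2a = subst (suc (n ℕ.+ n) ∤_) (sym (ℤₚ.abs-* (+ 2) a)) (∤-* isPrime (>⇒∤ 2<p) p∤a)

    xa≋a : x * a P¹.≋ a
    xa≋a = begin
      x * a        ≈⟨ ≋-weaken xa≋a-Pb ⟩
      a - P * b    ≡⟨ identity a P b ⟩
      a + - b * P  ≈⟨ +-multiple-≋ (- b) a ⟩
      a            ∎
      where
      open P¹
      identity : ∀ a P b → a - P * b ≡ a + - b * P
      identity = solve-∀

    4ⁿ≋1 : y P¹.≋ + 1
    4ⁿ≋1 = ≋-cancelˡ 1 (+ 2 * a) isPrime P≡p¹ p∤2a (begin
      + 2 * a * y          ≡⟨ double a y ⟩
      y * a + y * a        ≈⟨ ≋-+ (≋-refl {y * a}) (≋-*ˡ y (≋-sym xa≋a)) ⟩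
      y * a + y * (x * a)  ≡⟨ factor y a x ⟩
      y * a * (+ 1 + x)    ≈⟨ ≋-sym (≋-weaken 2xa≋ya[1+x]) ⟩
      + 2 * (x * a)        ≈⟨ ≋-*ˡ (+ 2) xa≋a ⟩
      + 2 * a              ≡⟨ sym (ℤₚ.*-identityʳ (+ 2 * a)) ⟩
      + 2 * a * + 1        ∎)
      where
      open P¹
      double : ∀ a y → + 2 * a * y ≡ y * a + y * a
      double = solve-∀
      factor : ∀ y a x → y * a + y * (x * a) ≡ y * a * (+ 1 + x)
      factor = solve-∀

    morley : x P².≋ y * y
    morley = ≋-cancelˡ 2 a isPrime P²≡p² p∤a (begin
      a * x        ≡⟨ ℤₚ.*-comm a x ⟩
      x * a        ≈⟨ 2xa≋ya[1+x]⇒xa≋y²a {P} {a} {x} {y} xa≋a 4ⁿ≋1 2xa≋ya[1+x] ⟩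
      y * y * a    ≡⟨ ℤₚ.*-comm (y * y) a ⟩
      a * (y * y)  ∎)
      where open P²

    B≋Ly² : B P².≋ L * (y * y)
    B≋Ly² = begin
      B            ≡⟨ sym (trans (sym (ℤₚ.*-assoc L L B)) (trans (cong (_* B) L²≡1) (ℤₚ.*-identityˡ B))) ⟩
      L * x        ≈⟨ ≋-*ˡ L morley ⟩
      L * (y * y)  ∎
      where
      open P²
      L²≡1 : L * L ≡ + 1
      L²≡1 = trans (sym (^-distribʳ-* (- + 1) (- + 1) n)) (ℤₚ.^-zeroˡ n)

-- The factorials, double factorials and harmonic sums of the theorem

-- With k standing for the theorem's k - 1: u = (2k-1)!, h₁ = u H_{2k-1},
-- v = (k-1)!, h₂ = v H_{k-1}, o = (2k-1)!!, s = o Σ_{j≤k} 1/(2j-1),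
-- W = 2^(k-1) and G = 2k C(2k,k).
module OddFactorials where

  u h₁ v h₂ o s W G : ℕ → ℤ
  u  k = ∏ (suc (k ℕ.+ k)) (λ j → + j)
  h₁ k = ∂∏ (suc (k ℕ.+ k)) (λ j → + j)
  v  k = ∏ k (λ j → + j)
  h₂ k = ∂∏ k (λ j → + j)
  o  k = ∏ (suc k) odd
  s  k = ∂∏ (suc k) odd
  W  k = (+ 2) ^ k
  G  k = + (2 ℕ.* suc k ℕ.* centralBinomial (suc k))

  private
    2k+2 2k+3 k+1 : ℕ → ℤ
    2k+2 k = + 2 + + 2 * + k
    2k+3 k = + 3 + + 2 * + k
    k+1  k = + 1 + + k

    length-suc : ∀ k → suc (suc k ℕ.+ suc k) ≡ 3 ℕ.+ (k ℕ.+ k)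
    length-suc k = cong (λ m → suc (suc m)) (ℕₚ.+-suc k k)

  u-suc : ∀ k → u (suc k) ≡ u k * 2k+2 k * 2k+3 k
  u-suc k = trans (cong (λ m → ∏ m (λ j → + j)) (length-suc k))
                  (cong₂ (λ c d → u k * c * d) (pos-m+2k 2 k) (pos-m+2k 3 k))

  h₁-suc : ∀ k → h₁ (suc k) ≡ (h₁ k * 2k+2 k + u k) * 2k+3 k + u k * 2k+2 k
  h₁-suc k = trans (cong (λ m → ∂∏ m (λ j → + j)) (length-suc k))
                   (cong₂ (λ c d → (h₁ k * c + u k) * d + u k * c) (pos-m+2k 2 k) (pos-m+2k 3 k))

  v-suc : ∀ k → v (suc k) ≡ v k * k+1 k
  v-suc k = cong (v k *_) (ℤₚ.pos-+ 1 k)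

  h₂-suc : ∀ k → h₂ (suc k) ≡ h₂ k * k+1 k + v k
  h₂-suc k = cong (λ c → h₂ k * c + v k) (ℤₚ.pos-+ 1 k)

  o-suc : ∀ k → o (suc k) ≡ o k * 2k+3 k
  o-suc k = cong (o k *_) (odd-suc k)

  s-suc : ∀ k → s (suc k) ≡ s k * 2k+3 k + o k
  s-suc k = cong (λ c → s k * c + o k) (odd-suc k)

  G≡ : ∀ k → G k ≡ + 2 * k+1 k * + centralBinomial (suc k)
  G≡ k = trans (ℤₚ.pos-* (2 ℕ.* suc k) (centralBinomial (suc k)))
               (cong (_* + centralBinomial (suc k)) (trans (ℤₚ.pos-* 2 (suc k)) (cong (+ 2 *_) (ℤₚ.pos-+ 1 k))))

  u≡Wvo : ∀ k → u k ≡ W k * v k * o k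
  u≡Wvo zero    = refl
  u≡Wvo (suc k) = begin
    u (suc k)                                   ≡⟨ u-suc k ⟩
    u k * 2k+2 k * 2k+3 k                       ≡⟨ cong (λ c → c * 2k+2 k * 2k+3 k) (u≡Wvo k) ⟩
    W k * v k * o k * 2k+2 k * 2k+3 k           ≡⟨ regroup (W k) (v k) (o k) (+ k) ⟩
    + 2 * W k * (v k * k+1 k) * (o k * 2k+3 k)  ≡⟨ sym (cong₂ (λ c d → + 2 * W k * c * d) (v-suc k) (o-suc k)) ⟩
    W (suc k) * v (suc k) * o (suc k)           ∎
    where
    open ≡-Reasoning
    regroup : ∀ W v o k → W * v * o * (+ 2 + + 2 * k) * (+ 3 + + 2 * k)
                        ≡ + 2 * W * (v * (+ 1 + k)) * (o * (+ 3 + + 2 * k))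
    regroup = solve-∀

  Gv≡4Wo : ∀ k → G k * v k ≡ + 4 * W k * o k
  Gv≡4Wo zero    = refl
  Gv≡4Wo (suc k) = begin
    G (suc k) * v (suc k)
      ≡⟨ cong₂ _*_ (G≡ (suc k)) (v-suc k) ⟩
    + 2 * k+1 (suc k) * C₂ * (v k * k+1 k)
      ≡⟨ cong (λ c → + 2 * c * C₂ * (v k * k+1 k)) (ℤₚ.pos-+ 1 (suc k)) ⟩
    + 2 * (+ 1 + + suc k) * C₂ * (v k * k+1 k)
      ≡⟨ regroup₁ C₂ (v k) (+ k) (+ suc k) (pos-suc k) ⟩
    + 2 * k+1 k * (C₂ * + suc (suc k)) * v k
      ≡⟨ cong (λ c → + 2 * k+1 k * c * v k) (centralBinomial-suc-ℤ (suc k)) ⟩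
    + 2 * k+1 k * (+ 2 * (+ 2 * + suc k + + 1) * C₁) * v k
      ≡⟨ regroup₂ C₁ (v k) (+ k) (+ suc k) (pos-suc k) ⟩
    + 2 * 2k+3 k * (+ 2 * k+1 k * C₁ * v k)
      ≡⟨ cong (λ c → + 2 * 2k+3 k * (c * v k)) (sym (G≡ k)) ⟩
    + 2 * 2k+3 k * (G k * v k)
      ≡⟨ cong (+ 2 * 2k+3 k *_) (Gv≡4Wo k) ⟩
    + 2 * 2k+3 k * (+ 4 * W k * o k)
      ≡⟨ regroup₃ (W k) (o k) (+ k) ⟩
    + 4 * (+ 2 * W k) * (o k * 2k+3 k)
      ≡⟨ cong (+ 4 * (+ 2 * W k) *_) (sym (o-suc k)) ⟩
    + 4 * W (suc k) * o (suc k) ∎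
    where
    open ≡-Reasoning
    C₁ = + centralBinomial (suc k)
    C₂ = + centralBinomial (suc (suc k))
    regroup₁ : ∀ Cb v k k′ → k′ ≡ k + + 1 →
      + 2 * (+ 1 + k′) * Cb * (v * (+ 1 + k)) ≡ + 2 * (+ 1 + k) * (Cb * (+ 1 + k′)) * v
    regroup₁ Cb v k k′ refl = identity Cb v k
      where identity : ∀ Cb v k → + 2 * (+ 1 + (k + + 1)) * Cb * (v * (+ 1 + k)) ≡ + 2 * (+ 1 + k) * (Cb * (+ 1 + (k + + 1))) * v
            identity = solve-∀
    regroup₂ : ∀ Cb v k k′ → k′ ≡ k + + 1 →
      + 2 * (+ 1 + k) * (+ 2 * (+ 2 * k′ + + 1) * Cb) * v ≡ + 2 * (+ 3 + + 2 * k) * (+ 2 * (+ 1 + k) * Cb * v)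
    regroup₂ Cb v k k′ refl = identity Cb v k
      where identity : ∀ Cb v k → + 2 * (+ 1 + k) * (+ 2 * (+ 2 * (k + + 1) + + 1) * Cb) * v ≡ + 2 * (+ 3 + + 2 * k) * (+ 2 * (+ 1 + k) * Cb * v)
            identity = solve-∀
    regroup₃ : ∀ W o k → + 2 * (+ 3 + + 2 * k) * (+ 4 * W * o) ≡ + 4 * (+ 2 * W) * (o * (+ 3 + + 2 * k))
    regroup₃ = solve-∀

  harmonic-split : ∀ k → + 2 * h₁ k * v k * o k ≡ h₂ k * u k * o k + + 2 * s k * u k * v k
  harmonic-split k = ℤₚ.i-j≡0⇒i≡j _ _ (defect≡0 k)
    where
    defect : ℤ → ℤ → ℤ → ℤ → ℤ → ℤ → ℤ
    defect h₁ v o h₂ u s = + 2 * h₁ * v * o - (h₂ * u * o + + 2 * s * u * v)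

    defect-cong : ∀ {h₁ h₁′ v v′ o o′ h₂ h₂′ u u′ s s′} →
      h₁ ≡ h₁′ → v ≡ v′ → o ≡ o′ → h₂ ≡ h₂′ → u ≡ u′ → s ≡ s′ → defect h₁ v o h₂ u s ≡ defect h₁′ v′ o′ h₂′ u′ s′
    defect-cong refl refl refl refl refl refl = refl

    step : ∀ h₁ v o h₂ u s k →
      + 2 * ((h₁ * (+ 2 + + 2 * k) + u) * (+ 3 + + 2 * k) + u * (+ 2 + + 2 * k)) * (v * (+ 1 + k)) * (o * (+ 3 + + 2 * k))
      - ((h₂ * (+ 1 + k) + v) * (u * (+ 2 + + 2 * k) * (+ 3 + + 2 * k)) * (o * (+ 3 + + 2 * k))
         + + 2 * (s * (+ 3 + + 2 * k) + o) * (u * (+ 2 + + 2 * k) * (+ 3 + + 2 * k)) * (v * (+ 1 + k)))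
      ≡ (+ 2 + + 2 * k) * ((+ 3 + + 2 * k) * (+ 3 + + 2 * k)) * (+ 1 + k)
        * (+ 2 * h₁ * v * o - (h₂ * u * o + + 2 * s * u * v))
    step = solve-∀

    defect≡0 : ∀ k → defect (h₁ k) (v k) (o k) (h₂ k) (u k) (s k) ≡ + 0
    defect≡0 zero    = refl
    defect≡0 (suc k) = begin
      defect (h₁ (suc k)) (v (suc k)) (o (suc k)) (h₂ (suc k)) (u (suc k)) (s (suc k))
        ≡⟨ trans (defect-cong (h₁-suc k) (v-suc k) (o-suc k) (h₂-suc k) (u-suc k) (s-suc k))
                 (step (h₁ k) (v k) (o k) (h₂ k) (u k) (s k) (+ k)) ⟩
      c * defect (h₁ k) (v k) (o k) (h₂ k) (u k) (s k)  ≡⟨ cong (c *_) (defect≡0 k) ⟩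
      c * + 0                                            ≡⟨ ℤₚ.*-zeroʳ c ⟩
      + 0                                                ∎
      where
      open ≡-Reasoning
      c = 2k+2 k * (2k+3 k * 2k+3 k) * k+1 k

-- The binomial of the theorem

module CentralBinomialShift (n : ℕ) where
  open Morley n using (P; B)

  Q R B⁺ : ℕ → ℤ
  Q k = ∏ (suc k) (λ j → odd j + + 1 * P)
  R k = ∏ (suc (k ℕ.+ k)) (λ j → + j + + 1 * P)
  B⁺ k = + centralBinomial (n ℕ.+ suc k)

  -- With m = n + k + 1 the factors are f = 2(m + 1), g₁ = 2m + 1 and g₂ = 2(m + 1).
  step-factors : ∀ k →
    + 2 * (+ 2 * + (n ℕ.+ suc k) + + 1) * ((odd (suc (suc k)) + + 1 * P) * (odd (suc (suc k)) + + 1 * P))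
    ≡ + 4 * ((+ (2 ℕ.+ (k ℕ.+ k)) + + 1 * P) * (+ (3 ℕ.+ (k ℕ.+ k)) + + 1 * P)) * + suc (n ℕ.+ suc k)
  step-factors k = begin
    + 2 * (+ 2 * + m + + 1) * (f * f)
      ≡⟨ cong₂ (λ M F → + 2 * (+ 2 * M + + 1) * (F * F)) +m≡ (cong (_+ + 1 * P) (odd-suc k)) ⟩
    + 2 * (+ 2 * (+ n + + k + + 1) + + 1) * ((+ 3 + + 2 * + k + + 1 * P) * (+ 3 + + 2 * + k + + 1 * P))
      ≡⟨ identity (+ n) (+ k) ⟩
    + 4 * ((+ 2 + + 2 * + k + + 1 * P) * (+ 3 + + 2 * + k + + 1 * P)) * (+ n + + k + + 1 + + 1)
      ≡⟨ sym (cong₂ (λ c d → + 4 * ((c + + 1 * P) * (d + + 1 * P)) * (+ n + + k + + 1 + + 1)) (pos-m+2k 2 k) (pos-m+2k 3 k)) ⟩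
    + 4 * (g₁ * g₂) * (+ n + + k + + 1 + + 1)
      ≡⟨ cong (λ c → + 4 * (g₁ * g₂) * c) (sym (trans (pos-suc m) (cong (_+ + 1) +m≡))) ⟩
    + 4 * (g₁ * g₂) * + suc m ∎
    where
    open ≡-Reasoning
    m = n ℕ.+ suc k
    f g₁ g₂ : ℤ
    f  = odd (suc (suc k)) + + 1 * P
    g₁ = + (2 ℕ.+ (k ℕ.+ k)) + + 1 * P
    g₂ = + (3 ℕ.+ (k ℕ.+ k)) + + 1 * P
    +m≡ : + m ≡ + n + + k + + 1
    +m≡ = trans (ℤₚ.pos-+ n (suc k)) (trans (cong (_+_ (+ n)) (pos-suc k)) (sym (ℤₚ.+-assoc (+ n) (+ k) (+ 1))))
    identity : ∀ n k →
      + 2 * (+ 2 * (n + k + + 1) + + 1) * ((+ 3 + + 2 * k + + 1 * (n + n + + 1)) * (+ 3 + + 2 * k + + 1 * (n + n + + 1)))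
      ≡ + 4 * ((+ 2 + + 2 * k + + 1 * (n + n + + 1)) * (+ 3 + + 2 * k + + 1 * (n + n + + 1))) * (n + k + + 1 + + 1)
    identity = solve-∀

  B⁺Q²≡PB4ᵏR : ∀ k → B⁺ k * (Q k * Q k) ≡ P * B * (+ 4) ^ suc k * R k
  B⁺Q²≡PB4ᵏR zero = ℤₚ.*-cancelʳ-≡ _ _ (+ suc n) (begin
    B⁺ zero * (Q zero * Q zero) * + suc n
      ≡⟨ cong (λ m → + centralBinomial m * (Q zero * Q zero) * + suc n) (ℕₚ.+-comm n 1) ⟩
    + centralBinomial (suc n) * (Q zero * Q zero) * + suc n
      ≡⟨ regroup (+ centralBinomial (suc n)) (+ suc n) (Q zero) ⟩
    + centralBinomial (suc n) * + suc n * (Q zero * Q zero)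
      ≡⟨ cong (_* (Q zero * Q zero)) (centralBinomial-suc-ℤ n) ⟩
    + 2 * (+ 2 * + n + + 1) * B * (Q zero * Q zero)
      ≡⟨ identity B (+ n) ⟩
    P * B * (+ 4) ^ 1 * R zero * (+ n + + 1)
      ≡⟨ cong (P * B * (+ 4) ^ 1 * R zero *_) (sym (pos-suc n)) ⟩
    P * B * (+ 4) ^ 1 * R zero * + suc n ∎)
    where
    open ≡-Reasoning
    regroup : ∀ X M q → X * (q * q) * M ≡ X * M * (q * q)
    regroup = solve-∀
    identity : ∀ B n →
      + 2 * (+ 2 * n + + 1) * B * ((+ 1 * ((+ 2 * + 1 - + 1) + + 1 * (n + n + + 1))) * (+ 1 * ((+ 2 * + 1 - + 1) + + 1 * (n + n + + 1))))
      ≡ (n + n + + 1) * B * (+ 4 * + 1) * (+ 1 * (+ 1 + + 1 * (n + n + + 1))) * (n + + 1)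
    identity = solve-∀
  B⁺Q²≡PB4ᵏR (suc k) = ℤₚ.*-cancelʳ-≡ _ _ (+ suc m) (begin
    B⁺ (suc k) * (Q (suc k) * Q (suc k)) * + suc m
      ≡⟨ cong (λ m → + centralBinomial m * (Q (suc k) * Q (suc k)) * + suc (n ℕ.+ suc k)) (ℕₚ.+-suc n (suc k)) ⟩
    + centralBinomial (suc m) * ((Q k * f) * (Q k * f)) * + suc m
      ≡⟨ regroup₁ (+ centralBinomial (suc m)) (+ suc m) (Q k) f ⟩
    + centralBinomial (suc m) * + suc m * (Q k * Q k) * (f * f)
      ≡⟨ cong (λ c → c * (Q k * Q k) * (f * f)) (centralBinomial-suc-ℤ m) ⟩
    + 2 * (+ 2 * + m + + 1) * B⁺ k * (Q k * Q k) * (f * f)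
      ≡⟨ regroup₂ (+ 2 * (+ 2 * + m + + 1)) (B⁺ k) (Q k * Q k) (f * f) ⟩
    + 2 * (+ 2 * + m + + 1) * (B⁺ k * (Q k * Q k)) * (f * f)
      ≡⟨ cong (λ c → + 2 * (+ 2 * + m + + 1) * c * (f * f)) (B⁺Q²≡PB4ᵏR k) ⟩
    + 2 * (+ 2 * + m + + 1) * (P * B * (+ 4) ^ suc k * R k) * (f * f)
      ≡⟨ regroup₃ (+ 2 * (+ 2 * + m + + 1)) (P * B * (+ 4) ^ suc k * R k) (f * f) ⟩
    P * B * (+ 4) ^ suc k * R k * (+ 2 * (+ 2 * + m + + 1) * (f * f))
      ≡⟨ cong (P * B * (+ 4) ^ suc k * R k *_) (step-factors k) ⟩
    P * B * (+ 4) ^ suc k * R k * (+ 4 * (g₁ * g₂) * + suc m)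
      ≡⟨ regroup₄ P B ((+ 4) ^ suc k) (R k) g₁ g₂ (+ suc m) ⟩
    P * B * (+ 4) ^ suc (suc k) * (R k * g₁ * g₂) * + suc m
      ≡⟨ cong (λ l → P * B * (+ 4) ^ suc (suc k) * ∏ l (λ j → + j + + 1 * P) * + suc m)
              (sym (cong (λ l → suc (suc l)) (ℕₚ.+-suc k k))) ⟩
    P * B * (+ 4) ^ suc (suc k) * R (suc k) * + suc m ∎)
    where
    open ≡-Reasoning
    m = n ℕ.+ suc k
    f g₁ g₂ : ℤ
    f  = odd (suc (suc k)) + + 1 * P
    g₁ = + (2 ℕ.+ (k ℕ.+ k)) + + 1 * P
    g₂ = + (3 ℕ.+ (k ℕ.+ k)) + + 1 * P
    regroup₁ : ∀ X M q f → X * ((q * f) * (q * f)) * M ≡ X * M * (q * q) * (f * f)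
    regroup₁ = solve-∀
    regroup₂ : ∀ a X q f → a * X * q * f ≡ a * (X * q) * f
    regroup₂ = solve-∀
    regroup₃ : ∀ a X f → a * X * f ≡ X * (a * f)
    regroup₃ = solve-∀
    regroup₄ : ∀ P B W R g h M → P * B * W * R * (+ 4 * (g * h) * M) ≡ P * B * (+ 4 * W) * (R * g * h) * M
    regroup₄ = solve-∀

-- Here p = 2n + 1 and the theorem's k is suc k.
module ShiftedCentralBinomial (n : ℕ) (isPrime : Prime (suc (n ℕ.+ n))) (k : ℕ) (k<n : suc k ≤ n) where
  open Morley n
  open CentralBinomialShift n
  open OddFactorials

  p : ℕ
  p = suc (n ℕ.+ n)

  K K₂ T : ℤ
  K  = (+ 4) ^ suc k
  K₂ = (+ 4) ^ (suc k ℕ.+ suc k)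
  T  = u k * v k - P * (h₁ k * v k - h₂ k * u k)

  2k+1<p : suc (k ℕ.+ k) < p
  2k+1<p = s≤s (ℕₚ.+-mono-≤ k<n (ℕₚ.≤-trans (ℕₚ.n≤1+n k) k<n))

  k<p : k < p
  k<p = ℕₚ.≤-<-trans (ℕₚ.≤-trans (ℕₚ.m≤m+n k k) (ℕₚ.n≤1+n (k ℕ.+ k))) 2k+1<p

  p∤u : p ∤ ∣ u k ∣
  p∤u = subst (λ z → p ∤ ∣ z ∣) (sym (∏-identity (suc (k ℕ.+ k)))) (∤-! isPrime 2k+1<p)

  p∤v : p ∤ ∣ v k ∣
  p∤v = subst (λ z → p ∤ ∣ z ∣) (sym (∏-identity k)) (∤-! isPrime k<p)

  p∤o : p ∤ ∣ o k ∣
  p∤o = ∤-*ℤ⇒∤ʳ (W k * v k) (o k) (subst (λ z → p ∤ ∣ z ∣) (u≡Wvo k) p∤u)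

  p∤G : p ∤ ∣ G k ∣
  p∤G = ∤-*ℤ⇒∤ˡ (G k) (v k) (subst (λ z → p ∤ ∣ z ∣) (sym (Gv≡4Wo k)) p∤4Wo)
    where
    p∤4 : p ∤ 4
    p∤4 = ∤-* isPrime (>⇒∤ (2<p isPrime)) (>⇒∤ (2<p isPrime))
    p∤W : p ∤ ∣ W k ∣
    p∤W = subst (λ z → p ∤ ∣ z ∣) (pos-^ 2 k) (∤-2^ k isPrime (2<p isPrime))
    p∤4Wo : p ∤ ∣ + 4 * W k * o k ∣
    p∤4Wo = ∤-*ℤ (+ 4 * W k) (o k) isPrime (∤-*ℤ (+ 4) (W k) isPrime p∤4 p∤W) p∤o

  Q≋o+Ps : Q k P².≋ o k + P * s k
  Q≋o+Ps = P².≋-trans (∏-perturb P (+ 1) (suc k) odd)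
                      (P².≡⇒≋ (cong (_+_ (o k)) (cong (_* s k) (ℤₚ.*-identityˡ P))))

  R≋u+Ph₁ : R k P².≋ u k + P * h₁ k
  R≋u+Ph₁ = P².≋-trans (∏-perturb P (+ 1) (suc (k ℕ.+ k)) (λ j → + j))
                       (P².≡⇒≋ (cong (_+_ (u k)) (cong (_* h₁ k) (ℤₚ.*-identityˡ P))))

  Q≋o : Q k P¹.≋ o k
  Q≋o = begin
    Q k             ≈⟨ ≋-weaken Q≋o+Ps ⟩
    o k + P * s k   ≡⟨ cong (_+_ (o k)) (ℤₚ.*-comm P (s k)) ⟩
    o k + s k * P   ≈⟨ +-multiple-≋ (s k) (o k) ⟩
    o k             ∎
    where open P¹

  p∤Q : p ∤ ∣ Q k ∣
  p∤Q p∣Q = p∤o (∣⇒∣ᵤ (subst (_∣ o k) (sym P≡) (P¹.≋-resp-∣ Q≋o (subst (_∣ Q k) P≡ (∣ᵤ⇒∣ p∣Q)))))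

  P∣B⁺ : P ∣ B⁺ k
  P∣B⁺ = subst (_∣ B⁺ k) (sym (P≡p¹ isPrime))
    (^∣-cancelˡ-ℤ 1 (Q k * Q k) (B⁺ k) isPrime (∤-*ℤ (Q k) (Q k) isPrime p∤Q p∤Q)
      (subst (_∣ Q k * Q k * B⁺ k) (P≡p¹ isPrime) (divides (B * K * R k)
        (trans (ℤₚ.*-comm (Q k * Q k) (B⁺ k)) (trans (B⁺Q²≡PB4ᵏR k) (regroup P B K (R k)))))))
    where regroup : ∀ P B K R → P * B * K * R ≡ B * K * R * P
          regroup = solve-∀

  A : ℤ
  A = _∣_.quotient P∣B⁺

  AQ²≡BKR : A * (Q k * Q k) ≡ B * K * R k
  AQ²≡BKR = ℤₚ.*-cancelʳ-≡ _ _ (+ p) (subst (λ c → A * (Q k * Q k) * c ≡ B * K * R k * c) (sym P≡) (begin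
    A * (Q k * Q k) * P   ≡⟨ regroup A (Q k) P ⟩
    A * P * (Q k * Q k)   ≡⟨ cong (_* (Q k * Q k)) (sym (_∣_.equality P∣B⁺)) ⟩
    B⁺ k * (Q k * Q k)     ≡⟨ B⁺Q²≡PB4ᵏR k ⟩
    P * B * K * R k       ≡⟨ regroup′ P B K (R k) ⟩
    B * K * R k * P       ∎))
    where
    open ≡-Reasoning
    regroup : ∀ A Q P → A * (Q * Q) * P ≡ A * P * (Q * Q)
    regroup = solve-∀
    regroup′ : ∀ P B K R → P * B * K * R ≡ B * K * R * P
    regroup′ = solve-∀

  A[o+Ps]²≋BK[u+Ph₁] : A * ((o k + P * s k) * (o k + P * s k)) P².≋ B * K * (u k + P * h₁ k)
  A[o+Ps]²≋BK[u+Ph₁] = begin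
    A * ((o k + P * s k) * (o k + P * s k))  ≈⟨ ≋-sym (≋-*ˡ A (≋-* Q≋o+Ps Q≋o+Ps)) ⟩
    A * (Q k * Q k)                          ≡⟨ AQ²≡BKR ⟩
    B * K * R k                              ≈⟨ ≋-*ˡ (B * K) R≋u+Ph₁ ⟩
    B * K * (u k + P * h₁ k)                 ∎
    where open P²

  PAo²≋PBKu : P * (A * (o k * o k)) P².≋ P * (B * K * u k)
  PAo²≋PBKu = begin
    P * (A * (o k * o k))
      ≡⟨ expand A (o k) (s k) P ⟩
    P * (A * ((o k + P * s k) * (o k + P * s k))) + - (A * (+ 2 * o k * s k + P * s k * s k)) * (P * P)
      ≈⟨ +-multiple-≋ (- (A * (+ 2 * o k * s k + P * s k * s k))) (P * (A * ((o k + P * s k) * (o k + P * s k)))) ⟩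
    P * (A * ((o k + P * s k) * (o k + P * s k)))
      ≈⟨ ≋-*ˡ P A[o+Ps]²≋BK[u+Ph₁] ⟩
    P * (B * K * (u k + P * h₁ k))
      ≡⟨ expand′ B K (u k) P (h₁ k) ⟩
    P * (B * K * u k) + B * K * h₁ k * (P * P)
      ≈⟨ +-multiple-≋ (B * K * h₁ k) (P * (B * K * u k)) ⟩
    P * (B * K * u k) ∎
    where
    open P²
    expand : ∀ A o s P → P * (A * (o * o)) ≡ P * (A * ((o + P * s) * (o + P * s))) + - (A * (+ 2 * o * s + P * s * s)) * (P * P)
    expand = solve-∀
    expand′ : ∀ B K u P h → P * (B * K * (u + P * h)) ≡ P * (B * K * u) + B * K * h * (P * P)
    expand′ = solve-∀

  Ao³≋BK[ou+P[oh₁-2su]] : o k * (A * (o k * o k)) P².≋ B * K * (o k * u k + P * (o k * h₁ k - + 2 * s k * u k))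
  Ao³≋BK[ou+P[oh₁-2su]] = begin
    o k * (A * (o k * o k))
      ≡⟨ expand A (o k) (s k) P ⟩
    o k * (A * ((o k + P * s k) * (o k + P * s k))) + - (+ 2 * s k) * (P * (A * (o k * o k))) + - (o k * A * s k * s k) * (P * P)
      ≈⟨ +-multiple-≋ (- (o k * A * s k * s k)) (o k * (A * ((o k + P * s k) * (o k + P * s k))) + - (+ 2 * s k) * (P * (A * (o k * o k)))) ⟩
    o k * (A * ((o k + P * s k) * (o k + P * s k))) + - (+ 2 * s k) * (P * (A * (o k * o k)))
      ≈⟨ ≋-+ (≋-*ˡ (o k) A[o+Ps]²≋BK[u+Ph₁]) (≋-*ˡ (- (+ 2 * s k)) PAo²≋PBKu) ⟩
    o k * (B * K * (u k + P * h₁ k)) + - (+ 2 * s k) * (P * (B * K * u k))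
      ≡⟨ collect B K (o k) (u k) P (h₁ k) (s k) ⟩
    B * K * (o k * u k + P * (o k * h₁ k - + 2 * s k * u k)) ∎
    where
    open P²
    expand : ∀ A o s P → o * (A * (o * o)) ≡ o * (A * ((o + P * s) * (o + P * s))) + - (+ 2 * s) * (P * (A * (o * o))) + - (o * A * s * s) * (P * P)
    expand = solve-∀
    collect : ∀ B K o u P h s → o * (B * K * (u + P * h)) + - (+ 2 * s) * (P * (B * K * u)) ≡ B * K * (o * u + P * (o * h - + 2 * s * u))
    collect = solve-∀

  harmonic-elimination : + 4 * W k * u k * (B * K * (o k * u k + P * (o k * h₁ k - + 2 * s k * u k)))
                         ≡ o k * o k * (B * K₂ * T)
  harmonic-elimination = begin
    + 4 * W k * u k * (B * K * (o k * u k + P * (o k * h₁ k - + 2 * s k * u k)))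
      ≡⟨ cong (λ c → + 4 * W k * u k * (B * c * (o k * u k + P * (o k * h₁ k - + 2 * s k * u k)))) K≡4W² ⟩
    + 4 * W k * u k * (B * 4W² * (o k * u k + P * (o k * h₁ k - + 2 * s k * u k)))
      ≡⟨ identity (W k) (v k) (o k) (h₁ k) (h₂ k) (s k) B P (u k) (u≡Wvo k) ⟩
    o k * o k * (B * (4W² * 4W²) * T) + c * (+ 2 * h₁ k * v k * o k - (h₂ k * u k * o k + + 2 * s k * u k * v k))
      ≡⟨ cong (λ d → o k * o k * (B * (4W² * 4W²) * T) + c * d) (ℤₚ.i≡j⇒i-j≡0 (harmonic-split k)) ⟩
    o k * o k * (B * (4W² * 4W²) * T) + c * + 0
      ≡⟨ trans (cong (_+_ (o k * o k * (B * (4W² * 4W²) * T))) (ℤₚ.*-zeroʳ c)) (ℤₚ.+-identityʳ _) ⟩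
    o k * o k * (B * (4W² * 4W²) * T)
      ≡⟨ cong (λ c → o k * o k * (B * c * T)) (sym (trans K₂≡K² (cong₂ _*_ K≡4W² K≡4W²))) ⟩
    o k * o k * (B * K₂ * T) ∎
    where
    open ≡-Reasoning
    4W² = + 4 * (W k * W k)
    c = + 16 * W k * W k * W k * W k * B * o k * P
    K≡4W² : K ≡ 4W²
    K≡4W² = cong (+ 4 *_) (^-distribʳ-* (+ 2) (+ 2) k)
    K₂≡K² : K₂ ≡ K * K
    K₂≡K² = ℤₚ.^-distribˡ-+-* (+ 4) (suc k) (suc k)
    identity : ∀ W v o h₁ h₂ s B P u → u ≡ W * v * o →
      + 4 * W * u * (B * (+ 4 * (W * W)) * (o * u + P * (o * h₁ - + 2 * s * u)))
      ≡ o * o * (B * (+ 4 * (W * W) * (+ 4 * (W * W))) * (u * v - P * (h₁ * v - h₂ * u)))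
        + (+ 16 * W * W * W * W * B * o * P) * (+ 2 * h₁ * v * o - (h₂ * u * o + + 2 * s * u * v))
    identity W v o h₁ h₂ s B P _ refl = solve W v o h₁ h₂ s B P
      where solve : ∀ W v o h₁ h₂ s B P →
              + 4 * W * (W * v * o) * (B * (+ 4 * (W * W)) * (o * (W * v * o) + P * (o * h₁ - + 2 * s * (W * v * o))))
              ≡ o * o * (B * (+ 4 * (W * W) * (+ 4 * (W * W))) * ((W * v * o) * v - P * (h₁ * v - h₂ * (W * v * o))))
                + (+ 16 * W * W * W * W * B * o * P) * (+ 2 * h₁ * v * o - (h₂ * (W * v * o) * o + + 2 * s * (W * v * o) * v))
            solve = solve-∀

  AGuv≋Ly²K₂T : A * G k * u k * v k P².≋ L * (y * y) * K₂ * T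
  AGuv≋Ly²K₂T = ≋-cancelˡ 2 (o k * o k) isPrime (P²≡p² isPrime) (∤-*ℤ (o k) (o k) isPrime p∤o p∤o) (begin
    o k * o k * (A * G k * u k * v k)            ≡⟨ regroup₁ (o k) A (G k) (u k) (v k) ⟩
    o k * o k * A * u k * (G k * v k)            ≡⟨ cong (o k * o k * A * u k *_) (Gv≡4Wo k) ⟩
    o k * o k * A * u k * (+ 4 * W k * o k)      ≡⟨ regroup₂ (o k) A (u k) (W k) ⟩
    + 4 * W k * u k * (o k * (A * (o k * o k)))  ≈⟨ ≋-*ˡ (+ 4 * W k * u k) Ao³≋BK[ou+P[oh₁-2su]] ⟩
    + 4 * W k * u k * (B * K * (o k * u k + P * (o k * h₁ k - + 2 * s k * u k)))
                                                 ≡⟨ harmonic-elimination ⟩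
    o k * o k * (B * K₂ * T)                     ≈⟨ ≋-*ˡ (o k * o k) (≋-*ʳ T (≋-*ʳ K₂ (B≋Ly² isPrime))) ⟩
    o k * o k * (L * (y * y) * K₂ * T)           ∎)
    where
    open P²
    regroup₁ : ∀ o A G u v → o * o * (A * G * u * v) ≡ o * o * A * u * (G * v)
    regroup₁ = solve-∀
    regroup₂ : ∀ o A u W → o * o * A * u * (+ 4 * W * o) ≡ + 4 * W * u * (o * (A * (o * o)))
    regroup₂ = solve-∀

  AG≋LK₂ : A * G k P¹.≋ L * K₂
  AG≋LK₂ = ≋-cancelˡ 1 (u k * v k) isPrime (P≡p¹ isPrime) (∤-*ℤ (u k) (v k) isPrime p∤u p∤v) (begin
    u k * v k * (A * G k)                 ≡⟨ regroup₁ (u k) (v k) A (G k) ⟩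
    A * G k * u k * v k                   ≈⟨ ≋-weaken AGuv≋Ly²K₂T ⟩
    L * (y * y) * K₂ * T                  ≡⟨ expand L (y * y) K₂ (u k) (v k) P (h₁ k) (h₂ k) ⟩
    L * (y * y) * K₂ * (u k * v k) + - (L * (y * y) * K₂ * (h₁ k * v k - h₂ k * u k)) * P
      ≈⟨ +-multiple-≋ (- (L * (y * y) * K₂ * (h₁ k * v k - h₂ k * u k))) (L * (y * y) * K₂ * (u k * v k)) ⟩
    L * (y * y) * K₂ * (u k * v k)        ≈⟨ ≋-*ʳ (u k * v k) (≋-*ʳ K₂ (≋-*ˡ L (≋-* (4ⁿ≋1 isPrime) (4ⁿ≋1 isPrime)))) ⟩
    L * (+ 1 * + 1) * K₂ * (u k * v k)    ≡⟨ regroup₂ L K₂ (u k * v k) ⟩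
    u k * v k * (L * K₂)                  ∎)
    where
    open P¹
    regroup₁ : ∀ u v A G → u * v * (A * G) ≡ A * G * u * v
    regroup₁ = solve-∀
    expand : ∀ L Y K u v P h₁ h₂ → L * Y * K * (u * v - P * (h₁ * v - h₂ * u)) ≡ L * Y * K * (u * v) + - (L * Y * K * (h₁ * v - h₂ * u)) * P
    expand = solve-∀
    regroup₂ : ∀ L K X → L * (+ 1 * + 1) * K * X ≡ X * (L * K)
    regroup₂ = solve-∀

-- From integers to rationals

ℚ-ring : ACR.AlmostCommutativeRing 0ℓ 0ℓ
ℚ-ring = ACR.fromCommutativeRing ℚₚ.+-*-commutativeRing isZero
  where
  isZero : ∀ x → Maybe (0ℚ ≡ x)
  isZero x with 0ℚ ℚₚ.≟ x
  ... | yes 0≡x = just 0≡x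
  ... | no  _   = nothing

fromℤ : ℤ → ℚ
fromℤ z = z ℚ./ 1

toℚᵘ-fromℤ : ∀ z → toℚᵘ (fromℤ z) ℚᵘ.≃ mkℚᵘ z 0
toℚᵘ-fromℤ z = ℚₚ.toℚᵘ-fromℚᵘ (mkℚᵘ z 0)

fromℤ-+ : ∀ a b → fromℤ (a + b) ≡ fromℤ a ℚ.+ fromℤ b
fromℤ-+ a b = ℚₚ.toℚᵘ-injective (ℚᵘₚ.≃-trans (toℚᵘ-fromℤ (a + b)) (ℚᵘₚ.≃-trans (*≡* (identity a b))
  (ℚᵘₚ.≃-sym (ℚᵘₚ.≃-trans (ℚₚ.toℚᵘ-homo-+ (fromℤ a) (fromℤ b)) (ℚᵘₚ.+-cong (toℚᵘ-fromℤ a) (toℚᵘ-fromℤ b))))))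
  where identity : ∀ a b → (a + b) * + 1 ≡ (a * + 1 + b * + 1) * + 1
        identity = solve-∀

fromℤ-* : ∀ a b → fromℤ (a * b) ≡ fromℤ a ℚ.* fromℤ b
fromℤ-* a b = ℚₚ.toℚᵘ-injective (ℚᵘₚ.≃-trans (toℚᵘ-fromℤ (a * b)) (ℚᵘₚ.≃-trans (*≡* refl)
  (ℚᵘₚ.≃-sym (ℚᵘₚ.≃-trans (ℚₚ.toℚᵘ-homo-* (fromℤ a) (fromℤ b)) (ℚᵘₚ.*-cong (toℚᵘ-fromℤ a) (toℚᵘ-fromℤ b))))))

fromℤ-neg : ∀ a → fromℤ (- a) ≡ ℚ.- fromℤ a
fromℤ-neg a = ℚₚ.toℚᵘ-injective (ℚᵘₚ.≃-trans (toℚᵘ-fromℤ (- a))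
  (ℚᵘₚ.≃-sym (ℚᵘₚ.≃-trans (ℚₚ.toℚᵘ-homo‿- (fromℤ a)) (ℚᵘₚ.-‿cong (toℚᵘ-fromℤ a)))))

fromℤ-difference : ∀ a b → fromℤ (a - b) ≡ fromℤ a ℚ.- fromℤ b
fromℤ-difference a b = trans (fromℤ-+ a (- b)) (cong (fromℤ a ℚ.+_) (fromℤ-neg b))

fracℕ-split : ∀ a N → fracℕ a N ≡ fromℤ (+ a) ℚ.* fracℕ 1 N
fracℕ-split a zero    = sym (ℚₚ.*-zeroʳ (fromℤ (+ a)))
fracℕ-split a (suc d) = ℚₚ.toℚᵘ-injective (ℚᵘₚ.≃-trans (ℚₚ.toℚᵘ-fromℚᵘ (mkℚᵘ (+ a) d))
  (ℚᵘₚ.≃-trans (*≡* cross) (ℚᵘₚ.≃-sym (ℚᵘₚ.≃-trans (ℚₚ.toℚᵘ-homo-* (fromℤ (+ a)) (fracℕ 1 (suc d)))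
    (ℚᵘₚ.*-cong (toℚᵘ-fromℤ (+ a)) (ℚₚ.toℚᵘ-fromℚᵘ (mkℚᵘ (+ 1) d)))))))
  where cross : + a * + suc (0 ℕ.+ d ℕ.+ 0 ℕ.* d) ≡ + a * + 1 * + suc d
        cross = trans (cong (λ m → + a * + suc m) (ℕₚ.+-identityʳ d)) (cong (_* + suc d) (sym (ℤₚ.*-identityʳ (+ a))))

fracℕ-inverse : ∀ N .{{_ : NonZero N}} → fracℕ 1 N ℚ.* fromℤ (+ N) ≡ 1ℚ
fracℕ-inverse (suc d) = ℚₚ.toℚᵘ-injective (ℚᵘₚ.≃-trans (ℚₚ.toℚᵘ-homo-* (fracℕ 1 (suc d)) (fromℤ (+ suc d)))
  (ℚᵘₚ.≃-trans (ℚᵘₚ.*-cong (ℚₚ.toℚᵘ-fromℚᵘ (mkℚᵘ (+ 1) d)) (toℚᵘ-fromℤ (+ suc d))) (*≡* cross)))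
  where cross : (+ 1 * + suc d) * + 1 ≡ + 1 * + suc (d ℕ.* 1)
        cross = trans (ℤₚ.*-identityʳ (+ 1 * + suc d)) (cong (λ m → + 1 * + suc m) (sym (ℕₚ.*-identityʳ d)))

H≡ : ∀ m → H m ≡ fromℤ (∂∏ m (λ j → + j)) ℚ.* fracℕ 1 (m !)
H≡ zero    = sym (ℚₚ.*-zeroˡ (fracℕ 1 1))
H≡ (suc m) = begin
  H m ℚ.+ I₂                                        ≡⟨ cong (ℚ._+ I₂) (H≡ m) ⟩
  h ℚ.* I₁ ℚ.+ I₂                                   ≡⟨ sym (ℚₚ.*-identityʳ (h ℚ.* I₁ ℚ.+ I₂)) ⟩
  (h ℚ.* I₁ ℚ.+ I₂) ℚ.* 1ℚ                          ≡⟨ cong ((h ℚ.* I₁ ℚ.+ I₂) ℚ.*_) (sym I₃SF≡1) ⟩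
  (h ℚ.* I₁ ℚ.+ I₂) ℚ.* (I₃ ℚ.* (S ℚ.* F))          ≡⟨ regroup h I₁ I₂ I₃ S F ⟩
  h ℚ.* S ℚ.* I₃ ℚ.* (I₁ ℚ.* F) ℚ.+ F ℚ.* I₃ ℚ.* (I₂ ℚ.* S)
    ≡⟨ cong₂ (λ c d → h ℚ.* S ℚ.* I₃ ℚ.* c ℚ.+ F ℚ.* I₃ ℚ.* d)
             (fracℕ-inverse (m !) {{ℕₚ._!≢0 m}}) (fracℕ-inverse (suc m)) ⟩
  h ℚ.* S ℚ.* I₃ ℚ.* 1ℚ ℚ.+ F ℚ.* I₃ ℚ.* 1ℚ         ≡⟨ collect h S I₃ F ⟩
  (h ℚ.* S ℚ.+ F) ℚ.* I₃                            ≡⟨ cong (ℚ._* I₃) (sym numerator) ⟩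
  fromℤ (∂∏ (suc m) (λ j → + j)) ℚ.* I₃             ∎
  where
  open ≡-Reasoning
  h  = fromℤ (∂∏ m (λ j → + j))
  I₁ = fracℕ 1 (m !)
  I₂ = fracℕ 1 (suc m)
  I₃ = fracℕ 1 (suc m !)
  S  = fromℤ (+ suc m)
  F  = fromℤ (+ (m !))
  I₃SF≡1 : I₃ ℚ.* (S ℚ.* F) ≡ 1ℚ
  I₃SF≡1 = trans (cong (I₃ ℚ.*_) (sym (trans (cong fromℤ (ℤₚ.pos-* (suc m) (m !))) (fromℤ-* (+ suc m) (+ (m !))))))
    (fracℕ-inverse (suc m !) {{ℕₚ._!≢0 (suc m)}})
  numerator : fromℤ (∂∏ (suc m) (λ j → + j)) ≡ h ℚ.* S ℚ.+ F
  numerator = trans (cong (λ c → fromℤ (∂∏ m (λ j → + j) * + suc m + c)) (∏-identity m))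
    (trans (fromℤ-+ (∂∏ m (λ j → + j) * + suc m) (+ (m !))) (cong (ℚ._+ F) (fromℤ-* (∂∏ m (λ j → + j)) (+ suc m))))
  regroup : ∀ h I₁ I₂ I₃ S F → (h ℚ.* I₁ ℚ.+ I₂) ℚ.* (I₃ ℚ.* (S ℚ.* F))
                             ≡ h ℚ.* S ℚ.* I₃ ℚ.* (I₁ ℚ.* F) ℚ.+ F ℚ.* I₃ ℚ.* (I₂ ℚ.* S)
  regroup = ℚ-solve-∀ ℚ-ring
  collect : ∀ h S I₃ F → h ℚ.* S ℚ.* I₃ ℚ.* 1ℚ ℚ.+ F ℚ.* I₃ ℚ.* 1ℚ ≡ (h ℚ.* S ℚ.+ F) ℚ.* I₃
  collect = ℚ-solve-∀ ℚ-ring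

ℚ-divisibility : ∀ {p} r z N M → Prime p → p ∤ N → z ℚ.* fromℤ (+ N) ≡ fromℤ M → + (p ℕ.^ r) ∣ M →
                 p ℕ.^ r ∣ℕ ∣ ℚ.↥ z ∣ × p ∤ ℚ.↧ₙ z
ℚ-divisibility {p} r z zero M isPrime p∤0 _ _ = contradiction (p ℕ∣.∣0) p∤0
ℚ-divisibility {p} r z@(mkℚ a d coprime) N@(suc _) M isPrime p∤N zN≡M pʳ∣M = pʳ∣a , p∤d
  where
  cross : a * + N ≡ M * + suc d
  cross with ℚᵘₚ.≃-trans
    (ℚᵘₚ.≃-sym (ℚᵘₚ.≃-trans (ℚₚ.toℚᵘ-homo-* z (fromℤ (+ N))) (ℚᵘₚ.*-congˡ {toℚᵘ z} (toℚᵘ-fromℤ (+ N)))))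
    (ℚᵘₚ.≃-trans (ℚₚ.toℚᵘ-cong zN≡M) (toℚᵘ-fromℤ M))
  ... | *≡* e = trans (sym (ℤₚ.*-identityʳ (a * + N))) (trans e (cong (λ m → M * + suc m) (ℕₚ.*-identityʳ d)))
  ∣a∣N≡∣M∣d : ∣ a ∣ ℕ.* N ≡ ∣ M ∣ ℕ.* suc d
  ∣a∣N≡∣M∣d = trans (sym (ℤₚ.abs-* a (+ N))) (trans (cong ∣_∣ cross) (ℤₚ.abs-* M (+ suc d)))
  p∤d : p ∤ suc d
  p∤d p∣d = p∤N (ℕ∣.∣-trans p∣d
    (Coprimality.coprime-divisor (Coprimality.sym (Coprimality.recompute coprime)) (ℕ∣.divides ∣ M ∣ ∣a∣N≡∣M∣d)))
  pʳ∣a : p ℕ.^ r ∣ℕ ∣ a ∣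
  pʳ∣a = ^∣-cancelʳ r isPrime p∤N (subst (p ℕ.^ r ∣ℕ_) (sym ∣a∣N≡∣M∣d) (ℕ∣.∣m⇒∣m*n (suc d) (∣⇒∣ᵤ pʳ∣M)))

≡[mod]-from-ℤ : ∀ {p} r x y N M → Prime p → p ∤ N →
                (x ℚ.- y) ℚ.* fromℤ (+ N) ≡ fromℤ M → + (p ℕ.^ r) ∣ M → x ≡ y [mod p ^ r ]
≡[mod]-from-ℤ r x y = ℚ-divisibility r (x ℚ.- y)

scaled-difference : ∀ x y a d m → x ≡ fromℤ a → y ℚ.* fromℤ d ≡ fromℤ m →
                    (x ℚ.- y) ℚ.* fromℤ d ≡ fromℤ (a * d - m)
scaled-difference x y a d m refl yd≡m = begin
  (fromℤ a ℚ.- y) ℚ.* fromℤ d                  ≡⟨ ℚₚ.*-distribʳ-+ (fromℤ d) (fromℤ a) (ℚ.- y) ⟩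
  fromℤ a ℚ.* fromℤ d ℚ.+ (ℚ.- y) ℚ.* fromℤ d
    ≡⟨ cong₂ ℚ._+_ (sym (fromℤ-* a d)) (trans (sym (ℚₚ.neg-distribˡ-* y (fromℤ d))) (cong ℚ.-_ yd≡m)) ⟩
  fromℤ (a * d) ℚ.- fromℤ m                    ≡⟨ sym (fromℤ-difference (a * d) m) ⟩
  fromℤ (a * d - m)                            ∎
  where open ≡-Reasoning

half : ∀ n → (n ℕ.+ n) ℕ./ 2 ≡ n
half n = trans (cong (ℕ._/ 2) (double n)) (m*n/n≡m n 2)
  where double : ∀ n → n ℕ.+ n ≡ n ℕ.* 2
        double = ℕ-Solver.solve-∀

∤⇒nonZero : ∀ {p m} → p ∤ m → NonZero m
∤⇒nonZero {p} {zero}  p∤0 = contradiction (p ℕ∣.∣0) p∤0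
∤⇒nonZero {m = suc m} _   = _

module Congruences (n : ℕ) (isPrime : Prime (suc (n ℕ.+ n))) (k : ℕ) (k<n : suc k ≤ n) where
  open Morley n
  open CentralBinomialShift n
  open OddFactorials
  open ShiftedCentralBinomial n isPrime k k<n

  X : ℚ
  X = fracℕ ((n ℕ.+ n ℕ.+ 2 ℕ.* suc k) C ((n ℕ.+ n) ℕ./ 2 ℕ.+ suc k)) p

  X≡A : X ≡ fromℤ A
  X≡A = begin
    X                                       ≡⟨ cong (λ c → fracℕ c p) binomial≡ ⟩
    fracℕ (centralBinomial (n ℕ.+ suc k)) p ≡⟨ fracℕ-split (centralBinomial (n ℕ.+ suc k)) p ⟩
    fromℤ (B⁺ k) ℚ.* fracℕ 1 p              ≡⟨ cong (λ c → fromℤ c ℚ.* fracℕ 1 p) (_∣_.equality P∣B⁺) ⟩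
    fromℤ (A * P) ℚ.* fracℕ 1 p
      ≡⟨ cong (ℚ._* fracℕ 1 p) (trans (fromℤ-* A P) (cong (λ c → fromℤ A ℚ.* fromℤ c) (sym P≡))) ⟩
    fromℤ A ℚ.* fromℤ (+ p) ℚ.* fracℕ 1 p   ≡⟨ regroup (fromℤ A) (fromℤ (+ p)) (fracℕ 1 p) ⟩
    fromℤ A ℚ.* (fracℕ 1 p ℚ.* fromℤ (+ p)) ≡⟨ cong (fromℤ A ℚ.*_) (fracℕ-inverse p) ⟩
    fromℤ A ℚ.* 1ℚ                          ≡⟨ ℚₚ.*-identityʳ (fromℤ A) ⟩
    fromℤ A                                 ∎
    where
    open ≡-Reasoning
    binomial≡ : (n ℕ.+ n ℕ.+ 2 ℕ.* suc k) C ((n ℕ.+ n) ℕ./ 2 ℕ.+ suc k) ≡ centralBinomial (n ℕ.+ suc k)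
    binomial≡ = cong₂ _C_ (double n (suc k)) (cong (ℕ._+ suc k) (half n))
      where double : ∀ n k → n ℕ.+ n ℕ.+ 2 ℕ.* k ≡ 2 ℕ.* (n ℕ.+ k)
            double = ℕ-Solver.solve-∀
    regroup : ∀ a b c → a ℚ.* b ℚ.* c ≡ a ℚ.* (c ℚ.* b)
    regroup = ℚ-solve-∀ ℚ-ring

  Gₙ D : ℕ
  Gₙ = 2 ℕ.* suc k ℕ.* ((2 ℕ.* suc k) C suc k)
  D  = Gₙ ℕ.* suc (k ℕ.+ k) ! ℕ.* k !

  p∤D : p ∤ D
  p∤D = ∤-* isPrime (∤-* isPrime p∤G (∤-! isPrime 2k+1<p)) (∤-! isPrime k<p)

  +D≡Guv : + D ≡ G k * u k * v k
  +D≡Guv = trans (ℤₚ.pos-* (Gₙ ℕ.* suc (k ℕ.+ k) !) (k !))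
    (cong₂ _*_ (trans (ℤₚ.pos-* Gₙ (suc (k ℕ.+ k) !)) (cong (G k *_) (sym (∏-identity (suc (k ℕ.+ k))))))
               (sym (∏-identity k)))

  legendre≡L : legendre-1 p ≡ fromℤ L
  legendre≡L = cong (λ m → fromℤ ((- + 1) ^ m)) (half n)

  +4^[p-1]≡y² : + (4 ℕ.^ (n ℕ.+ n)) ≡ y * y
  +4^[p-1]≡y² = trans (pos-^ 4 (n ℕ.+ n)) (ℤₚ.^-distribˡ-+-* (+ 4) n n)

  +4^2k≡K₂ : + (4 ℕ.^ (2 ℕ.* suc k)) ≡ K₂
  +4^2k≡K₂ = trans (pos-^ 4 (2 ℕ.* suc k)) (cong (λ m → (+ 4) ^ (suc k ℕ.+ m)) (ℕₚ.+-identityʳ (suc k)))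

  H[2k-1]≡ : H (2 ℕ.* suc k ℕ.∸ 1) ≡ fromℤ (h₁ k) ℚ.* fracℕ 1 (suc (k ℕ.+ k) !)
  H[2k-1]≡ = trans (cong H 2k-1≡) (H≡ (suc (k ℕ.+ k)))
    where 2k-1≡ : 2 ℕ.* suc k ℕ.∸ 1 ≡ suc (k ℕ.+ k)
          2k-1≡ = trans (cong (λ m → suc k ℕ.+ m ℕ.∸ 1) (ℕₚ.+-identityʳ (suc k))) (ℕₚ.+-suc k k)

  Y₁ Y₂ : ℚ
  Y₁ = legendre-1 p ℚ.* fracℕ (4 ℕ.^ (p ℕ.∸ 1)) 1 ℚ.* fracℕ (4 ℕ.^ (2 ℕ.* suc k)) Gₙ
         ℚ.* (1ℚ ℚ.- fracℕ p 1 ℚ.* (H (2 ℕ.* suc k ℕ.∸ 1) ℚ.- H (suc k ℕ.∸ 1)))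
  Y₂ = legendre-1 p ℚ.* fracℕ (4 ℕ.^ (2 ℕ.* suc k)) Gₙ

  fracℕ-inverse-G : fracℕ 1 Gₙ ℚ.* fromℤ (G k) ≡ 1ℚ
  fracℕ-inverse-G = fracℕ-inverse Gₙ {{∤⇒nonZero p∤G}}

  private
    ⟦_⟧ : ℤ → ℚ
    ⟦_⟧ = fromℤ
    iG iu iv : ℚ
    iG = fracℕ 1 Gₙ
    iu = fracℕ 1 (suc (k ℕ.+ k) !)
    iv = fracℕ 1 (k !)

  iu-inverse : iu ℚ.* ⟦ u k ⟧ ≡ 1ℚ
  iu-inverse = trans (cong (λ c → iu ℚ.* ⟦ c ⟧) (∏-identity (suc (k ℕ.+ k))))
                     (fracℕ-inverse (suc (k ℕ.+ k) !) {{ℕₚ._!≢0 (suc (k ℕ.+ k))}})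

  iv-inverse : iv ℚ.* ⟦ v k ⟧ ≡ 1ℚ
  iv-inverse = trans (cong (λ c → iv ℚ.* ⟦ c ⟧) (∏-identity k)) (fracℕ-inverse (k !) {{ℕₚ._!≢0 k}})

  Y₁≡ : Y₁ ≡ ⟦ L ⟧ ℚ.* ⟦ y * y ⟧ ℚ.* (⟦ K₂ ⟧ ℚ.* iG) ℚ.* (1ℚ ℚ.- ⟦ P ⟧ ℚ.* (⟦ h₁ k ⟧ ℚ.* iu ℚ.- ⟦ h₂ k ⟧ ℚ.* iv))
  Y₁≡ = cong₂ (λ a b → a ℚ.* (1ℚ ℚ.- b))
    (cong₂ ℚ._*_ (cong₂ ℚ._*_ legendre≡L (cong fromℤ +4^[p-1]≡y²))
                 (trans (fracℕ-split (4 ℕ.^ (2 ℕ.* suc k)) Gₙ) (cong (λ c → ⟦ c ⟧ ℚ.* iG) +4^2k≡K₂)))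
    (cong₂ ℚ._*_ (cong fromℤ P≡) (cong₂ ℚ._-_ H[2k-1]≡ (H≡ k)))

  fromℤ-Ly²K₂T : fromℤ (L * (y * y) * K₂ * T)
    ≡ ⟦ L ⟧ ℚ.* ⟦ y * y ⟧ ℚ.* ⟦ K₂ ⟧ ℚ.* (⟦ u k ⟧ ℚ.* ⟦ v k ⟧ ℚ.- ⟦ P ⟧ ℚ.* (⟦ h₁ k ⟧ ℚ.* ⟦ v k ⟧ ℚ.- ⟦ h₂ k ⟧ ℚ.* ⟦ u k ⟧))
  fromℤ-Ly²K₂T = trans (fromℤ-* (L * (y * y) * K₂) T) (cong₂ ℚ._*_
    (trans (fromℤ-* (L * (y * y)) K₂) (cong (ℚ._* ⟦ K₂ ⟧) (fromℤ-* L (y * y))))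
    (trans (fromℤ-difference (u k * v k) (P * (h₁ k * v k - h₂ k * u k))) (cong₂ ℚ._-_ (fromℤ-* (u k) (v k))
      (trans (fromℤ-* P (h₁ k * v k - h₂ k * u k)) (cong (⟦ P ⟧ ℚ.*_) (trans (fromℤ-difference (h₁ k * v k) (h₂ k * u k))
        (cong₂ ℚ._-_ (fromℤ-* (h₁ k) (v k)) (fromℤ-* (h₂ k) (u k)))))))))

  Y₁D≡ : Y₁ ℚ.* fromℤ (+ D) ≡ fromℤ (L * (y * y) * K₂ * T)
  Y₁D≡ = begin
    Y₁ ℚ.* fromℤ (+ D)
      ≡⟨ cong₂ ℚ._*_ Y₁≡ (trans (cong fromℤ +D≡Guv)
           (trans (fromℤ-* (G k * u k) (v k)) (cong (ℚ._* ⟦ v k ⟧) (fromℤ-* (G k) (u k))))) ⟩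
    ⟦ L ⟧ ℚ.* ⟦ y * y ⟧ ℚ.* (⟦ K₂ ⟧ ℚ.* iG) ℚ.* (1ℚ ℚ.- ⟦ P ⟧ ℚ.* (⟦ h₁ k ⟧ ℚ.* iu ℚ.- ⟦ h₂ k ⟧ ℚ.* iv))
      ℚ.* (⟦ G k ⟧ ℚ.* ⟦ u k ⟧ ℚ.* ⟦ v k ⟧)
      ≡⟨ regroup ⟦ L ⟧ ⟦ y * y ⟧ ⟦ K₂ ⟧ iG ⟦ P ⟧ ⟦ h₁ k ⟧ iu ⟦ h₂ k ⟧ iv ⟦ G k ⟧ ⟦ u k ⟧ ⟦ v k ⟧ ⟩
    ⟦ L ⟧ ℚ.* ⟦ y * y ⟧ ℚ.* ⟦ K₂ ⟧ ℚ.* (iG ℚ.* ⟦ G k ⟧)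
      ℚ.* (⟦ u k ⟧ ℚ.* ⟦ v k ⟧ ℚ.- ⟦ P ⟧ ℚ.* (⟦ h₁ k ⟧ ℚ.* (iu ℚ.* ⟦ u k ⟧) ℚ.* ⟦ v k ⟧ ℚ.- ⟦ h₂ k ⟧ ℚ.* (iv ℚ.* ⟦ v k ⟧) ℚ.* ⟦ u k ⟧))
      ≡⟨ cong₂ (λ a b → ⟦ L ⟧ ℚ.* ⟦ y * y ⟧ ℚ.* ⟦ K₂ ⟧ ℚ.* a ℚ.* (⟦ u k ⟧ ℚ.* ⟦ v k ⟧ ℚ.- ⟦ P ⟧ ℚ.* b))
           fracℕ-inverse-G
           (cong₂ (λ a b → ⟦ h₁ k ⟧ ℚ.* a ℚ.* ⟦ v k ⟧ ℚ.- ⟦ h₂ k ⟧ ℚ.* b ℚ.* ⟦ u k ⟧) iu-inverse iv-inverse) ⟩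
    ⟦ L ⟧ ℚ.* ⟦ y * y ⟧ ℚ.* ⟦ K₂ ⟧ ℚ.* 1ℚ
      ℚ.* (⟦ u k ⟧ ℚ.* ⟦ v k ⟧ ℚ.- ⟦ P ⟧ ℚ.* (⟦ h₁ k ⟧ ℚ.* 1ℚ ℚ.* ⟦ v k ⟧ ℚ.- ⟦ h₂ k ⟧ ℚ.* 1ℚ ℚ.* ⟦ u k ⟧))
      ≡⟨ unit ⟦ L ⟧ ⟦ y * y ⟧ ⟦ K₂ ⟧ ⟦ P ⟧ ⟦ h₁ k ⟧ ⟦ h₂ k ⟧ ⟦ u k ⟧ ⟦ v k ⟧ ⟩
    ⟦ L ⟧ ℚ.* ⟦ y * y ⟧ ℚ.* ⟦ K₂ ⟧ ℚ.* (⟦ u k ⟧ ℚ.* ⟦ v k ⟧ ℚ.- ⟦ P ⟧ ℚ.* (⟦ h₁ k ⟧ ℚ.* ⟦ v k ⟧ ℚ.- ⟦ h₂ k ⟧ ℚ.* ⟦ u k ⟧))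
      ≡⟨ sym fromℤ-Ly²K₂T ⟩
    fromℤ (L * (y * y) * K₂ * T) ∎
    where
    open ≡-Reasoning
    regroup : ∀ l Y κ iG π η₁ iu η₂ iv g μ ν →
      l ℚ.* Y ℚ.* (κ ℚ.* iG) ℚ.* (1ℚ ℚ.- π ℚ.* (η₁ ℚ.* iu ℚ.- η₂ ℚ.* iv)) ℚ.* (g ℚ.* μ ℚ.* ν)
      ≡ l ℚ.* Y ℚ.* κ ℚ.* (iG ℚ.* g) ℚ.* (μ ℚ.* ν ℚ.- π ℚ.* (η₁ ℚ.* (iu ℚ.* μ) ℚ.* ν ℚ.- η₂ ℚ.* (iv ℚ.* ν) ℚ.* μ))
    regroup = ℚ-solve-∀ ℚ-ring
    unit : ∀ l Y κ π η₁ η₂ μ ν →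
      l ℚ.* Y ℚ.* κ ℚ.* 1ℚ ℚ.* (μ ℚ.* ν ℚ.- π ℚ.* (η₁ ℚ.* 1ℚ ℚ.* ν ℚ.- η₂ ℚ.* 1ℚ ℚ.* μ))
      ≡ l ℚ.* Y ℚ.* κ ℚ.* (μ ℚ.* ν ℚ.- π ℚ.* (η₁ ℚ.* ν ℚ.- η₂ ℚ.* μ))
    unit = ℚ-solve-∀ ℚ-ring

  Y₂G≡LK₂ : Y₂ ℚ.* fromℤ (G k) ≡ fromℤ (L * K₂)
  Y₂G≡LK₂ = begin
    Y₂ ℚ.* fromℤ (G k)
      ≡⟨ cong (ℚ._* fromℤ (G k)) (cong₂ ℚ._*_ legendre≡L
           (trans (fracℕ-split (4 ℕ.^ (2 ℕ.* suc k)) Gₙ) (cong (λ c → fromℤ c ℚ.* fracℕ 1 Gₙ) +4^2k≡K₂))) ⟩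
    fromℤ L ℚ.* (fromℤ K₂ ℚ.* fracℕ 1 Gₙ) ℚ.* fromℤ (G k) ≡⟨ regroup (fromℤ L) (fromℤ K₂) (fracℕ 1 Gₙ) (fromℤ (G k)) ⟩
    fromℤ L ℚ.* fromℤ K₂ ℚ.* (fracℕ 1 Gₙ ℚ.* fromℤ (G k)) ≡⟨ cong (fromℤ L ℚ.* fromℤ K₂ ℚ.*_) fracℕ-inverse-G ⟩
    fromℤ L ℚ.* fromℤ K₂ ℚ.* 1ℚ                          ≡⟨ trans (ℚₚ.*-identityʳ _) (sym (fromℤ-* L K₂)) ⟩
    fromℤ (L * K₂)                                        ∎
    where
    open ≡-Reasoning
    regroup : ∀ a b c d → a ℚ.* (b ℚ.* c) ℚ.* d ≡ a ℚ.* b ℚ.* (c ℚ.* d)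
    regroup = ℚ-solve-∀ ℚ-ring

  X≡Y₁ : X ≡ Y₁ [mod p ^ 2 ]
  X≡Y₁ = ≡[mod]-from-ℤ 2 X Y₁ D (A * + D - L * (y * y) * K₂ * T) isPrime p∤D
    (scaled-difference X Y₁ A (+ D) _ X≡A Y₁D≡)
    (subst (_∣ A * + D - L * (y * y) * K₂ * T) (P²≡p² isPrime)
      (P².∣-subst (cong (_- L * (y * y) * K₂ * T) (regroup A (G k) (u k) (v k) (+ D) +D≡Guv))
                  (P².divides-difference AGuv≋Ly²K₂T)))
    where
    regroup : ∀ A G u v d → d ≡ G * u * v → A * G * u * v ≡ A * d
    regroup A G u v _ refl = reassoc A G u v
      where reassoc : ∀ A G u v → A * G * u * v ≡ A * (G * u * v)
            reassoc = solve-∀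

  X≡Y₂ : X ≡ Y₂ [mod p ^ 1 ]
  X≡Y₂ = ≡[mod]-from-ℤ 1 X Y₂ Gₙ (A * G k - L * K₂) isPrime p∤G
    (scaled-difference X Y₂ A (G k) (L * K₂) X≡A Y₂G≡LK₂)
    (subst (_∣ A * G k - L * K₂) (P≡p¹ isPrime) (P¹.divides-difference AG≋LK₂))

prime>2⇒odd : ∀ {p} → Prime p → 2 < p → ∃[ n ] p ≡ suc (n ℕ.+ n)
prime>2⇒odd {suc q} isPrime 2<p with q ℕ.% 2 | m%n<n q 2 | m≡m%n+[m/n]*n q 2
... | 0 | _ | q≡ = q ℕ./ 2 , cong suc (trans q≡ (double (q ℕ./ 2)))
  where double : ∀ n → n ℕ.* 2 ≡ n ℕ.+ n
        double = ℕ-Solver.solve-∀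
... | 1 | _ | q≡ = contradiction (prime⇒irreducible isPrime (ℕ∣.divides (suc (q ℕ./ 2)) (trans (cong suc q≡) (even (q ℕ./ 2)))))
                                [ (λ ()) , (λ 2≡p → ℕₚ.<-irrefl 2≡p 2<p) ]′
  where even : ∀ n → suc (1 ℕ.+ n ℕ.* 2) ≡ suc n ℕ.* 2
        even = ℕ-Solver.solve-∀
... | suc (suc _) | s≤s (s≤s ()) | _

lemma3p3 : (p k : ℕ) → Prime p → 3 < p → 0 < k → k ≤ (p ℕ.∸ 1) ℕ./ 2 →
    (fracℕ ((p ℕ.∸ 1 ℕ.+ 2 ℕ.* k) C ((p ℕ.∸ 1) ℕ./ 2 ℕ.+ k)) p
      ≡ legendre-1 p ℚ.* fracℕ (4 ℕ.^ (p ℕ.∸ 1)) 1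
          ℚ.* fracℕ (4 ℕ.^ (2 ℕ.* k)) (2 ℕ.* k ℕ.* ((2 ℕ.* k) C k))
          ℚ.* (1ℚ ℚ.- fracℕ p 1 ℚ.* (H (2 ℕ.* k ℕ.∸ 1) ℚ.- H (k ℕ.∸ 1)))
      [mod p ^ 2 ])
    × (fracℕ ((p ℕ.∸ 1 ℕ.+ 2 ℕ.* k) C ((p ℕ.∸ 1) ℕ./ 2 ℕ.+ k)) p
      ≡ legendre-1 p ℚ.* fracℕ (4 ℕ.^ (2 ℕ.* k)) (2 ℕ.* k ℕ.* ((2 ℕ.* k) C k))
      [mod p ^ 1 ])
lemma3p3 p zero    _       _   ()
lemma3p3 p (suc k) isPrime 3<p _ k≤[p-1]/2 with prime>2⇒odd isPrime (ℕₚ.<-trans (ℕₚ.n<1+n 2) 3<p)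
... | n , refl = X≡Y₁ , X≡Y₂
  where open Congruences n isPrime k (subst (suc k ≤_) (half n) k≤[p-1]/2)
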